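{- Each of the following four graphs is $Z_3$-connected: (a) vertices $v_1,\ldots,v_6$ and edges $v_1v_2, v_1v_3, v_1v_5, v_1v_6, v_2v_4, v_2v_5, v_2v_6, v_3v_4, v_3v_5, v_4v_6$ (degree sequence $(4^2,3^4)$); (b) vertices $v_1,\ldots,v_7$ and edges $v_1v_2, v_1v_3, v_1v_4, v_1v_5, v_1v_7, v_2v_3, v_2v_6, v_2v_7, v_3v_4, v_4v_5, v_5v_6, v_6v_7$ (degree sequence $(5,4,3^5)$); (c) vertices $v_1,\ldots,v_8$ and edges $v_1v_3, v_1v_4, v_1v_5, v_1v_6, v_1v_7, v_1v_8, v_2v_3, v_2v_5, v_2v_6, v_2v_8, v_3v_4, v_4v_5, v_6v_7, v_7v_8$ (degree sequence $(6,4,3^6)$); (d) vertices $v_1,\ldots,v_8$ and edges $v_1v_3, v_1v_4, v_1v_5, v_1v_6, v_1v_8, v_2v_3, v_2v_5, v_2v_6, v_2v_7, v_2v_8, v_3v_4, v_4v_5, v_6v_7, v_7v_8$ (degree sequence $(5^2,3^6)$).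
   Context: $Z_3$ is the cyclic group of order 3. For a graph $G$ with an orientation and a map $f:E(G)\to Z_3$, the boundary $\partial f:V(G)\to Z_3$ is $\partial f(v)=\sum_{e\text{ with tail }v}f(e)-\sum_{e\text{ with head }v}f(e)$. A map $b:V(G)\to Z_3$ is zero-sum if $\sum_{v}b(v)=0$. $G$ is $Z_3$-connected if for every zero-sum $b$ there exist an orientation of $G$ and a map $f:E(G)\to Z_3\setminus\{0\}$ with $\partial f=b$. Exponents in degree sequences denote multiplicities. -}

module Defs where

open import Data.Nat using (ℕ; zero; suc)
open import Data.Fin using (Fin; zero; suc; _≟_)
open import Data.Fin.Patterns
open import Data.Bool using (Bool; true; false; if_then_else_)
open import Data.Product using (_×_; _,_; proj₁; proj₂; Σ; ∃)
open import Data.Vec using (Vec; lookup; []; _∷_)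
open import Relation.Nullary using (¬_; does)
open import Relation.Binary.PropositionalEquality using (_≡_)

Z3 : Set
Z3 = Fin 3

infixl 6 _⊕_
_⊕_ : Z3 → Z3 → Z3
0F ⊕ y = y
1F ⊕ 0F = 1F
1F ⊕ 1F = 2F
1F ⊕ 2F = 0F
2F ⊕ 0F = 2F
2F ⊕ 1F = 0F
2F ⊕ 2F = 1F

⊖_ : Z3 → Z3
⊖ 0F = 0F
⊖ 1F = 2F
⊖ 2F = 1F

ΣZ3 : (k : ℕ) → (Fin k → Z3) → Z3
ΣZ3 zero    g = 0F
ΣZ3 (suc k) g = g zero ⊕ ΣZ3 k (λ i → g (suc i))

-- A (multi)graph on vertex set Fin n with m edges, edge i being the
-- unordered pair of endpoints lookup E i (the pair order is irrelevant).
Graph : ℕ → ℕ → Set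
Graph n m = Vec (Fin n × Fin n) m

-- An orientation assigns to each edge a Bool: false means tail = first
-- endpoint, head = second endpoint; true means reversed.
Orientation : ℕ → Set
Orientation m = Fin m → Bool

tail head : ∀ {n m} → Graph n m → Orientation m → Fin m → Fin n
tail E o e = if o e then proj₂ (lookup E e) else proj₁ (lookup E e)
head E o e = if o e then proj₁ (lookup E e) else proj₂ (lookup E e)

at : ∀ {n} → Fin n → Fin n → Z3 → Z3
at v a x = if does (a ≟ v) then x else 0F

∂ : ∀ {n m} → Graph n m → Orientation m → (Fin m → Z3) → Fin n → Z3
∂ {n} {m} E o f v =
  ΣZ3 m (λ e → at v (tail E o e) (f e)) ⊕ (⊖ ΣZ3 m (λ e → at v (head E o e) (f e)))

ZeroSum : ∀ {n} → (Fin n → Z3) → Set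
ZeroSum {n} b = ΣZ3 n b ≡ 0F

Z3Connected : ∀ {n m} → Graph n m → Set
Z3Connected {n} {m} E =
  (b : Fin n → Z3) → ZeroSum b →
  Σ (Orientation m) λ o → Σ (Fin m → Z3) λ f →
    ((e : Fin m) → ¬ (f e ≡ 0F)) × ((v : Fin n) → ∂ E o f v ≡ b v)

-- The four graphs (vertex v_i is represented by Fin index i−1).
Ga : Graph 6 10
Ga = (0F , 1F) ∷ (0F , 2F) ∷ (0F , 4F) ∷ (0F , 5F) ∷ (1F , 3F) ∷ (1F , 4F)
   ∷ (1F , 5F) ∷ (2F , 3F) ∷ (2F , 4F) ∷ (3F , 5F) ∷ []

Gb : Graph 7 12
Gb = (0F , 1F) ∷ (0F , 2F) ∷ (0F , 3F) ∷ (0F , 4F) ∷ (0F , 6F) ∷ (1F , 2F)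
   ∷ (1F , 5F) ∷ (1F , 6F) ∷ (2F , 3F) ∷ (3F , 4F) ∷ (4F , 5F) ∷ (5F , 6F) ∷ []

Gc : Graph 8 14
Gc = (0F , 2F) ∷ (0F , 3F) ∷ (0F , 4F) ∷ (0F , 5F) ∷ (0F , 6F) ∷ (0F , 7F)
   ∷ (1F , 2F) ∷ (1F , 4F) ∷ (1F , 5F) ∷ (1F , 7F) ∷ (2F , 3F) ∷ (3F , 4F)
   ∷ (5F , 6F) ∷ (6F , 7F) ∷ []

Gd : Graph 8 14
Gd = (0F , 2F) ∷ (0F , 3F) ∷ (0F , 4F) ∷ (0F , 5F) ∷ (0F , 7F) ∷ (1F , 2F)
   ∷ (1F , 4F) ∷ (1F , 5F) ∷ (1F , 6F) ∷ (1F , 7F) ∷ (2F , 3F) ∷ (3F , 4F)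
   ∷ (5F , 6F) ∷ (6F , 7F) ∷ []

-- Z3-connectivity of a fixed finite graph is a finite statement, and we prove
-- it by checking a certificate by computation.
--
-- * Since the orientation is existentially quantified, it suffices to solve
--   every zero-sum boundary b with one fixed orientation, here the one directing
--   each edge from its first to its second listed endpoint (`Realises`,
--   `solvable⇒connected`).
-- * On n+1 vertices a zero-sum b is determined by b(v₀), …, b(vₙ₋₁), so a
--   solution for every b is given by a ternary table of depth n indexed by these
--   values (`Table`, `entry`).  Its entries encode nowhere-zero flows with values
--   in {1, 2} as natural numbers, one binary digit per edge (`decodeFlow`).
-- * `Certifies E t` says that the table t solves every zero-sum boundary of E.
--   It quantifies over the finite set Z3^(n+1), hence is decidable
--   (`certifies?`), and it implies Z3-connectivity (`certified⇒connected`).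
module Submission where

open import Defs
open import Data.Bool using (false; if_then_else_)
open import Data.Nat using (ℕ; zero; suc; _%_; _/_; _≡ᵇ_)
open import Data.Fin using (Fin; zero; suc; _≟_)
open import Data.Fin.Patterns using (0F; 1F; 2F)
open import Data.Fin.Properties using (all?)
open import Data.Product using (_×_; _,_; ∃)
open import Data.Vec using (Vec; []; _∷_; lookup; tabulate)
open import Data.Vec.Properties using (lookup∘tabulate)
open import Function using (_∘_)
open import Relation.Nullary using (Dec; ¬_; ¬?)
open import Relation.Nullary.Decidable using (_×-dec_; _→-dec_; map′; toWitness; True)
open import Relation.Binary.PropositionalEquality using (_≡_; _≗_; refl; sym; trans; cong₂)

forward : ∀ {m} → Orientation m
forward _ = false

Realises : ∀ {n m} → Graph n m → (Fin n → Z3) → (Fin m → Z3) → Set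
Realises E b f = (∀ e → ¬ f e ≡ 0F) × (∀ v → ∂ E forward f v ≡ b v)

solvable⇒connected : ∀ {n m} (E : Graph n m) →
  (∀ b → ZeroSum b → ∃ (Realises E b)) → Z3Connected E
solvable⇒connected E solve b zb = forward , solve b zb

-- ΣZ3 only depends on the values of the summand; this lets us pass between
-- boundaries given as functions and as vectors.
ΣZ3-cong : ∀ k {g h : Fin k → Z3} → g ≗ h → ΣZ3 k g ≡ ΣZ3 k h
ΣZ3-cong zero    g≗h = refl
ΣZ3-cong (suc k) g≗h = cong₂ _⊕_ (g≗h zero) (ΣZ3-cong k (g≗h ∘ suc))

zeroSum-resp : ∀ {n} {b b′ : Fin n → Z3} → b ≗ b′ → ZeroSum b → ZeroSum b′
zeroSum-resp {n} b≗b′ zb = trans (sym (ΣZ3-cong n b≗b′)) zb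

realises-resp : ∀ {n m} (E : Graph n m) {b b′ f} →
  b ≗ b′ → Realises E b f → Realises E b′ f
realises-resp E b≗b′ (nowhere-zero , boundary) =
  nowhere-zero , λ v → trans (boundary v) (b≗b′ v)

zeroSum? : ∀ {n} (b : Fin n → Z3) → Dec (ZeroSum b)
zeroSum? {n} b = ΣZ3 n b ≟ 0F

realises? : ∀ {n m} (E : Graph n m) b f → Dec (Realises E b f)
realises? E b f =
  all? (λ e → ¬? (f e ≟ 0F)) ×-dec all? (λ v → ∂ E forward f v ≟ b v)

∀-Vec? : ∀ {k n} {P : Vec (Fin k) n → Set} → (∀ w → Dec (P w)) → Dec (∀ w → P w)
∀-Vec? {n = zero} P? = map′ (λ p → λ { [] → p }) (λ ∀P → ∀P []) (P? [])
∀-Vec? {n = suc n} P? =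
  map′ (λ ∀P → λ { (i ∷ w) → ∀P i w }) (λ ∀P i w → ∀P (i ∷ w))
       (all? (λ i → ∀-Vec? (λ w → P? (i ∷ w))))

-- A function Z3^n → A, stored as a complete ternary tree.
data Table (A : Set) : ℕ → Set where
  leaf : A → Table A 0
  node : ∀ {n} → Table A n → Table A n → Table A n → Table A (suc n)

-- The entry of a table of depth n indexed by the first n coordinates of w; for a
-- zero-sum w the last coordinate is determined by these.
entry : ∀ {A n} → Table A n → Vec Z3 (suc n) → A
entry (leaf a)        (_ ∷ []) = a
entry (node t₀ t₁ t₂) (0F ∷ w) = entry t₀ w
entry (node t₀ t₁ t₂) (1F ∷ w) = entry t₁ w
entry (node t₀ t₁ t₂) (2F ∷ w) = entry t₂ w

decodeFlow : (m : ℕ) → ℕ → Vec Z3 m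
decodeFlow zero    k = []
decodeFlow (suc m) k = (if k % 2 ≡ᵇ 0 then 1F else 2F) ∷ decodeFlow m (k / 2)

flowFor : ∀ {n} m → Table ℕ n → Vec Z3 (suc n) → Fin m → Z3
flowFor m t w = lookup (decodeFlow m (entry t w))

Certifies : ∀ {n m} → Graph (suc n) m → Table ℕ n → Set
Certifies {m = m} E t = ∀ w → ZeroSum (lookup w) → Realises E (lookup w) (flowFor m t w)

certifies? : ∀ {n m} (E : Graph (suc n) m) (t : Table ℕ n) → Dec (Certifies E t)
certifies? {m = m} E t =
  ∀-Vec? (λ w → zeroSum? (lookup w) →-dec realises? E (lookup w) (flowFor m t w))

certified⇒connected : ∀ {n m} (E : Graph (suc n) m) (t : Table ℕ n) →
  Certifies E t → Z3Connected E
certified⇒connected {m = m} E t certified = solvable⇒connected E solve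
  where
  solve : ∀ b → ZeroSum b → ∃ (Realises E b)
  solve b zb = flowFor m t (tabulate b)
             , realises-resp E (lookup∘tabulate b)
                 (certified (tabulate b) (zeroSum-resp (sym ∘ lookup∘tabulate b) zb))

-- Z3-connectivity of E, established by running the certificate check on t; the
-- implicit argument is inferred once `certifies? E t` evaluates to `yes`.
connectedByCertificate : ∀ {n m} (E : Graph (suc n) m) (t : Table ℕ n) →
  {True (certifies? E t)} → Z3Connected E
connectedByCertificate E t {check} = certified⇒connected E t (toWitness check)

⟨_,_,_⟩ : ∀ {A} → A → A → A → Table A 1
⟨ a , b , c ⟩ = node (leaf a) (leaf b) (leaf c)

-- Certificates for the graphs (a)–(d), found by computer search.
certificateA : Table ℕ 5
certificateA =
  node
    (node
      (node
        (node ⟨ 586 , 412 , 554 ⟩ ⟨ 428 , 460 , 22 ⟩ ⟨ 940 , 972 , 42 ⟩)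
        (node ⟨ 154 , 556 , 588 ⟩ ⟨ 202 , 166 , 28 ⟩ ⟨ 714 , 44 , 76 ⟩)
        (node ⟨ 812 , 844 , 156 ⟩ ⟨ 422 , 172 , 204 ⟩ ⟨ 300 , 332 , 716 ⟩))
      (node
        (node ⟨ 444 , 476 , 618 ⟩ ⟨ 492 , 988 , 58 ⟩ ⟨ 1004 , 102 , 106 ⟩)
        (node ⟨ 218 , 620 , 186 ⟩ ⟨ 730 , 60 , 92 ⟩ ⟨ 358 , 108 , 604 ⟩)
        (node ⟨ 876 , 188 , 220 ⟩ ⟨ 316 , 236 , 732 ⟩ ⟨ 364 , 748 , 265 ⟩))
      (node
        (node ⟨ 508 , 405 , 518 ⟩ ⟨ 1020 , 396 , 122 ⟩ ⟨ 10 , 908 , 634 ⟩)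
        (node ⟨ 585 , 774 , 524 ⟩ ⟨ 138 , 124 , 762 ⟩ ⟨ 650 , 636 , 12 ⟩)
        (node ⟨ 502 , 780 , 841 ⟩ ⟨ 380 , 764 , 140 ⟩ ⟨ 892 , 268 , 652 ⟩)))
    (node
      (node
        (node ⟨ 445 , 558 , 400 ⟩ ⟨ 493 , 416 , 448 ⟩ ⟨ 1005 , 928 , 960 ⟩)
        (node ⟨ 576 , 846 , 544 ⟩ ⟨ 16 , 174 , 206 ⟩ ⟨ 64 , 334 , 32 ⟩)
        (node ⟨ 144 , 800 , 832 ⟩ ⟨ 192 , 462 , 160 ⟩ ⟨ 704 , 288 , 320 ⟩))
      (node
        (node ⟨ 509 , 432 , 464 ⟩ ⟨ 1021 , 480 , 976 ⟩ ⟨ 11 , 992 , 606 ⟩)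
        (node ⟨ 878 , 190 , 608 ⟩ ⟨ 80 , 238 , 48 ⟩ ⟨ 592 , 750 , 96 ⟩)
        (node ⟨ 208 , 864 , 176 ⟩ ⟨ 720 , 304 , 224 ⟩ ⟨ 1006 , 352 , 736 ⟩))
      (node
        (node ⟨ 587 , 496 , 526 ⟩ ⟨ 429 , 1008 , 384 ⟩ ⟨ 941 , 638 , 896 ⟩)
        (node ⟨ 512 , 782 , 589 ⟩ ⟨ 382 , 766 , 112 ⟩ ⟨ 0 , 270 , 624 ⟩)
        (node ⟨ 510 , 845 , 768 ⟩ ⟨ 128 , 368 , 752 ⟩ ⟨ 640 , 880 , 256 ⟩)))
    (node
      (node
        (node ⟨ 578 , 404 , 408 ⟩ ⟨ 420 , 424 , 456 ⟩ ⟨ 932 , 936 , 968 ⟩)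
        (node ⟨ 584 , 548 , 552 ⟩ ⟨ 24 , 239 , 20 ⟩ ⟨ 72 , 36 , 40 ⟩)
        (node ⟨ 152 , 808 , 840 ⟩ ⟨ 200 , 164 , 168 ⟩ ⟨ 712 , 296 , 328 ⟩))
      (node
        (node ⟨ 436 , 440 , 472 ⟩ ⟨ 484 , 488 , 984 ⟩ ⟨ 996 , 1000 , 98 ⟩)
        (node ⟨ 210 , 612 , 616 ⟩ ⟨ 88 , 52 , 56 ⟩ ⟨ 600 , 100 , 104 ⟩)
        (node ⟨ 216 , 872 , 184 ⟩ ⟨ 728 , 312 , 232 ⟩ ⟨ 356 , 360 , 744 ⟩))
      (node
        (node ⟨ 500 , 504 , 401 ⟩ ⟨ 1012 , 1016 , 392 ⟩ ⟨ 2 , 900 , 904 ⟩)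
        (node ⟨ 520 , 847 , 516 ⟩ ⟨ 130 , 116 , 120 ⟩ ⟨ 8 , 628 , 632 ⟩)
        (node ⟨ 145 , 772 , 776 ⟩ ⟨ 136 , 376 , 760 ⟩ ⟨ 648 , 888 , 264 ⟩)))

certificateB : Table ℕ 6
certificateB =
  node
    (node
      (node
        (node
          (node ⟨ 1348 , 1412 , 3460 ⟩ ⟨ 2594 , 477 , 546 ⟩ ⟨ 2436 , 324 , 388 ⟩)
          (node ⟨ 1360 , 1424 , 3472 ⟩ ⟨ 2440 , 328 , 392 ⟩ ⟨ 2448 , 336 , 400 ⟩)
          (node ⟨ 2952 , 840 , 904 ⟩ ⟨ 2960 , 848 , 912 ⟩ ⟨ 1872 , 1936 , 3984 ⟩))
        (node
          (node ⟨ 2600 , 731 , 552 ⟩ ⟨ 2608 , 1576 , 560 ⟩ ⟨ 1602 , 1584 , 3632 ⟩)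
          (node ⟨ 2878 , 1060 , 3108 ⟩ ⟨ 2206 , 94 , 158 ⟩ ⟨ 2084 , 1182 , 36 ⟩)
          (node ⟨ 1090 , 1072 , 3120 ⟩ ⟨ 2088 , 1694 , 40 ⟩ ⟨ 2096 , 1064 , 48 ⟩))
        (node
          (node ⟨ 2696 , 584 , 648 ⟩ ⟨ 2704 , 592 , 656 ⟩ ⟨ 1616 , 1680 , 3728 ⟩)
          (node ⟨ 1092 , 1328 , 3376 ⟩ ⟨ 2344 , 1950 , 296 ⟩ ⟨ 2352 , 1320 , 304 ⟩)
          (node ⟨ 1104 , 1168 , 3216 ⟩ ⟨ 2864 , 72 , 816 ⟩ ⟨ 2192 , 80 , 144 ⟩)))
      (node
        (node
          (node ⟨ 1476 , 3524 , 2811 ⟩ ⟨ 2722 , 610 , 674 ⟩ ⟨ 1634 , 452 , 2500 ⟩)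
          (node ⟨ 1488 , 3536 , 3329 ⟩ ⟨ 2238 , 456 , 2504 ⟩ ⟨ 1480 , 464 , 2512 ⟩)
          (node ⟨ 1122 , 968 , 3016 ⟩ ⟨ 1992 , 976 , 3024 ⟩ ⟨ 2000 , 4048 , 162 ⟩))
        (node
          (node ⟨ 2728 , 616 , 680 ⟩ ⟨ 2736 , 624 , 688 ⟩ ⟨ 1648 , 1712 , 3760 ⟩)
          (node ⟨ 1124 , 1188 , 3236 ⟩ ⟨ 1918 , 222 , 2270 ⟩ ⟨ 2212 , 100 , 164 ⟩)
          (node ⟨ 1136 , 1200 , 3248 ⟩ ⟨ 2216 , 104 , 168 ⟩ ⟨ 2224 , 112 , 176 ⟩))
        (node
          (node ⟨ 1380 , 712 , 2760 ⟩ ⟨ 1736 , 720 , 2768 ⟩ ⟨ 1744 , 3792 , 420 ⟩)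
          (node ⟨ 1392 , 1456 , 3504 ⟩ ⟨ 2472 , 360 , 424 ⟩ ⟨ 2480 , 368 , 432 ⟩)
          (node ⟨ 1232 , 3280 , 936 ⟩ ⟨ 2992 , 880 , 944 ⟩ ⟨ 1904 , 208 , 2256 ⟩)))
      (node
        (node
          (node ⟨ 2619 , 1284 , 3332 ⟩ ⟨ 2461 , 738 , 2786 ⟩ ⟨ 2308 , 3810 , 260 ⟩)
          (node ⟨ 1345 , 1296 , 3344 ⟩ ⟨ 2312 , 254 , 264 ⟩ ⟨ 2320 , 1288 , 272 ⟩)
          (node ⟨ 2824 , 3298 , 776 ⟩ ⟨ 2832 , 1800 , 784 ⟩ ⟨ 1857 , 1808 , 3856 ⟩))
        (node
          (node ⟨ 2715 , 744 , 2792 ⟩ ⟨ 1768 , 752 , 2800 ⟩ ⟨ 1776 , 3824 , 3586 ⟩)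
          (node ⟨ 1252 , 3300 , 3070 ⟩ ⟨ 2078 , 4094 , 30 ⟩ ⟨ 2199 , 228 , 2276 ⟩)
          (node ⟨ 1264 , 3312 , 3074 ⟩ ⟨ 2203 , 232 , 2280 ⟩ ⟨ 1256 , 240 , 2288 ⟩))
        (node
          (node ⟨ 2568 , 3556 , 520 ⟩ ⟨ 2576 , 1544 , 528 ⟩ ⟨ 1601 , 1552 , 3600 ⟩)
          (node ⟨ 1520 , 3568 , 3076 ⟩ ⟨ 2205 , 488 , 2536 ⟩ ⟨ 1512 , 496 , 2544 ⟩)
          (node ⟨ 1089 , 1040 , 3088 ⟩ ⟨ 2056 , 1008 , 3056 ⟩ ⟨ 2064 , 4080 , 16 ⟩))))
    (node
      (node
        (node
          (node ⟨ 1364 , 1428 , 3476 ⟩ ⟨ 2444 , 332 , 396 ⟩ ⟨ 2452 , 340 , 404 ⟩)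
          (node ⟨ 2956 , 844 , 908 ⟩ ⟨ 2456 , 344 , 408 ⟩ ⟨ 1368 , 1432 , 3480 ⟩)
          (node ⟨ 2968 , 856 , 920 ⟩ ⟨ 1880 , 1944 , 3992 ⟩ ⟨ 2098 , 1066 , 50 ⟩))
        (node
          (node ⟨ 2616 , 586 , 568 ⟩ ⟨ 2706 , 1592 , 3640 ⟩ ⟨ 1618 , 1682 , 3730 ⟩)
          (node ⟨ 1094 , 1076 , 3124 ⟩ ⟨ 2092 , 223 , 44 ⟩ ⟨ 2100 , 1068 , 52 ⟩)
          (node ⟨ 2604 , 1170 , 556 ⟩ ⟨ 2104 , 1580 , 56 ⟩ ⟨ 2194 , 1080 , 3128 ⟩))
        (node
          (node ⟨ 2712 , 600 , 664 ⟩ ⟨ 1624 , 1688 , 3736 ⟩ ⟨ 2356 , 1324 , 308 ⟩)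
          (node ⟨ 1108 , 1172 , 3220 ⟩ ⟨ 2360 , 76 , 312 ⟩ ⟨ 2196 , 1336 , 3384 ⟩)
          (node ⟨ 2872 , 588 , 824 ⟩ ⟨ 2200 , 88 , 152 ⟩ ⟨ 1112 , 1176 , 3224 ⟩)))
      (node
        (node
          (node ⟨ 1492 , 3540 , 682 ⟩ ⟨ 2738 , 460 , 2508 ⟩ ⟨ 1484 , 468 , 2516 ⟩)
          (node ⟨ 1126 , 972 , 3020 ⟩ ⟨ 1996 , 472 , 2520 ⟩ ⟨ 1496 , 3544 , 166 ⟩)
          (node ⟨ 1138 , 984 , 3032 ⟩ ⟨ 2008 , 4056 , 170 ⟩ ⟨ 2226 , 114 , 178 ⟩))
        (node
          (node ⟨ 2744 , 632 , 696 ⟩ ⟨ 1656 , 1720 , 3768 ⟩ ⟨ 1746 , 3794 , 422 ⟩)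
          (node ⟨ 1140 , 1204 , 3252 ⟩ ⟨ 2220 , 108 , 172 ⟩ ⟨ 2228 , 116 , 180 ⟩)
          (node ⟨ 2732 , 620 , 684 ⟩ ⟨ 2232 , 120 , 184 ⟩ ⟨ 1144 , 1208 , 3256 ⟩))
        (node
          (node ⟨ 1396 , 728 , 2776 ⟩ ⟨ 1752 , 3800 , 428 ⟩ ⟨ 2484 , 372 , 436 ⟩)
          (node ⟨ 1236 , 3284 , 940 ⟩ ⟨ 2488 , 376 , 440 ⟩ ⟨ 1400 , 1464 , 3512 ⟩)
          (node ⟨ 3000 , 888 , 952 ⟩ ⟨ 1912 , 216 , 2264 ⟩ ⟨ 1240 , 3288 , 17 ⟩)))
      (node
        (node
          (node ⟨ 1349 , 1300 , 3348 ⟩ ⟨ 2316 , 754 , 268 ⟩ ⟨ 2324 , 1292 , 276 ⟩)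
          (node ⟨ 2828 , 3302 , 780 ⟩ ⟨ 2328 , 1804 , 280 ⟩ ⟨ 2449 , 1304 , 3352 ⟩)
          (node ⟨ 2840 , 3314 , 792 ⟩ ⟨ 2961 , 1816 , 3864 ⟩ ⟨ 1258 , 242 , 2290 ⟩))
        (node
          (node ⟨ 2570 , 760 , 2808 ⟩ ⟨ 1784 , 3832 , 530 ⟩ ⟨ 1603 , 1554 , 3602 ⟩)
          (node ⟨ 1268 , 3316 , 3078 ⟩ ⟨ 2207 , 236 , 2284 ⟩ ⟨ 1260 , 244 , 2292 ⟩)
          (node ⟨ 1091 , 748 , 2796 ⟩ ⟨ 1772 , 248 , 2296 ⟩ ⟨ 1272 , 3320 , 18 ⟩))
        (node
          (node ⟨ 2584 , 3572 , 536 ⟩ ⟨ 2705 , 1560 , 3608 ⟩ ⟨ 1516 , 500 , 2548 ⟩)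
          (node ⟨ 1093 , 1044 , 3092 ⟩ ⟨ 2060 , 504 , 2552 ⟩ ⟨ 1528 , 3576 , 20 ⟩)
          (node ⟨ 2572 , 1016 , 3064 ⟩ ⟨ 2072 , 4088 , 24 ⟩ ⟨ 2193 , 1048 , 3096 ⟩))))
    (node
      (node
        (node
          (node ⟨ 2618 , 3541 , 570 ⟩ ⟨ 2460 , 348 , 412 ⟩ ⟨ 1372 , 1436 , 3484 ⟩)
          (node ⟨ 1344 , 1408 , 3456 ⟩ ⟨ 1884 , 1948 , 3996 ⟩ ⟨ 2432 , 320 , 384 ⟩)
          (node ⟨ 2606 , 985 , 558 ⟩ ⟨ 2944 , 832 , 896 ⟩ ⟨ 1856 , 1920 , 3968 ⟩))
        (node
          (node ⟨ 2714 , 602 , 666 ⟩ ⟨ 2592 , 1690 , 544 ⟩ ⟨ 2358 , 1568 , 3616 ⟩)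
          (node ⟨ 1110 , 1174 , 3222 ⟩ ⟨ 2108 , 78 , 60 ⟩ ⟨ 2198 , 1084 , 3132 ⟩)
          (node ⟨ 2620 , 1056 , 3104 ⟩ ⟨ 2202 , 1596 , 3644 ⟩ ⟨ 2080 , 1178 , 32 ⟩))
        (node
          (node ⟨ 1366 , 1430 , 3478 ⟩ ⟨ 2688 , 576 , 640 ⟩ ⟨ 1600 , 1664 , 3712 ⟩)
          (node ⟨ 2876 , 1312 , 3360 ⟩ ⟨ 2204 , 92 , 156 ⟩ ⟨ 2336 , 1180 , 288 ⟩)
          (node ⟨ 1088 , 1152 , 3200 ⟩ ⟨ 2848 , 1692 , 800 ⟩ ⟨ 2176 , 64 , 128 ⟩)))
      (node
        (node
          (node ⟨ 2746 , 634 , 698 ⟩ ⟨ 1658 , 476 , 2524 ⟩ ⟨ 1500 , 3548 , 277 ⟩)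
          (node ⟨ 1472 , 3520 , 3036 ⟩ ⟨ 2012 , 4060 , 174 ⟩ ⟨ 2230 , 448 , 2496 ⟩)
          (node ⟨ 2734 , 622 , 686 ⟩ ⟨ 2234 , 960 , 3008 ⟩ ⟨ 1984 , 4032 , 3258 ⟩))
        (node
          (node ⟨ 1398 , 730 , 2778 ⟩ ⟨ 2720 , 608 , 672 ⟩ ⟨ 1632 , 1696 , 3744 ⟩)
          (node ⟨ 1238 , 3286 , 942 ⟩ ⟨ 2236 , 124 , 188 ⟩ ⟨ 1148 , 1212 , 3260 ⟩)
          (node ⟨ 1120 , 1184 , 3232 ⟩ ⟨ 1660 , 1724 , 3772 ⟩ ⟨ 2208 , 96 , 160 ⟩))
        (node
          (node ⟨ 1494 , 3542 , 537 ⟩ ⟨ 2492 , 704 , 2752 ⟩ ⟨ 1728 , 3776 , 3516 ⟩)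
          (node ⟨ 1376 , 1440 , 3488 ⟩ ⟨ 1916 , 220 , 2268 ⟩ ⟨ 2464 , 352 , 416 ⟩)
          (node ⟨ 1216 , 3264 , 2780 ⟩ ⟨ 2976 , 864 , 928 ⟩ ⟨ 1888 , 192 , 2240 ⟩)))
      (node
        (node
          (node ⟨ 1365 , 762 , 2810 ⟩ ⟨ 2332 , 3834 , 284 ⟩ ⟨ 2453 , 1308 , 3356 ⟩)
          (node ⟨ 2844 , 1280 , 3328 ⟩ ⟨ 2457 , 1820 , 3868 ⟩ ⟨ 2304 , 246 , 256 ⟩)
          (node ⟨ 2969 , 750 , 2798 ⟩ ⟨ 2816 , 250 , 768 ⟩ ⟨ 1274 , 1792 , 3840 ⟩))
        (node
          (node ⟨ 2586 , 3574 , 538 ⟩ ⟨ 2707 , 736 , 2784 ⟩ ⟨ 1760 , 3808 , 2550 ⟩)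
          (node ⟨ 1095 , 1046 , 3094 ⟩ ⟨ 2062 , 252 , 2300 ⟩ ⟨ 1276 , 3324 , 22 ⟩)
          (node ⟨ 1248 , 3296 , 2812 ⟩ ⟨ 1788 , 3836 , 26 ⟩ ⟨ 2195 , 224 , 2272 ⟩))
        (node
          (node ⟨ 2713 , 1302 , 3350 ⟩ ⟨ 2560 , 508 , 512 ⟩ ⟨ 1532 , 1536 , 3584 ⟩)
          (node ⟨ 1504 , 3552 , 3068 ⟩ ⟨ 2076 , 4092 , 28 ⟩ ⟨ 2197 , 480 , 2528 ⟩)
          (node ⟨ 2588 , 1024 , 3072 ⟩ ⟨ 2201 , 992 , 3040 ⟩ ⟨ 2048 , 4064 , 0 ⟩))))

certificateC : Table ℕ 7
certificateC =
  node
    (node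
      (node
        (node
          (node
            (node ⟨ 10026 , 1818 , 1834 ⟩ ⟨ 5914 , 1842 , 10034 ⟩ ⟨ 5938 , 14130 , 2277 ⟩)
            (node ⟨ 5782 , 5798 , 13990 ⟩ ⟨ 9638 , 1430 , 1446 ⟩ ⟨ 9894 , 5542 , 1702 ⟩)
            (node ⟨ 5810 , 14002 , 1450 ⟩ ⟨ 9898 , 1458 , 9650 ⟩ ⟨ 5554 , 1714 , 9906 ⟩))
          (node
            (node ⟨ 7830 , 1848 , 10040 ⟩ ⟨ 9984 , 14136 , 1792 ⟩ ⟨ 11942 , 5888 , 14080 ⟩)
            (node ⟨ 5812 , 14004 , 1452 ⟩ ⟨ 9900 , 1460 , 9652 ⟩ ⟨ 5556 , 1716 , 9908 ⟩)
            (node ⟨ 10028 , 5760 , 13952 ⟩ ⟨ 9600 , 1720 , 1408 ⟩ ⟨ 9856 , 5504 , 1664 ⟩))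
          (node
            (node ⟨ 7860 , 16052 , 3500 ⟩ ⟨ 11948 , 3508 , 11700 ⟩ ⟨ 7604 , 3764 , 11956 ⟩)
            (node ⟨ 12076 , 7808 , 16000 ⟩ ⟨ 11648 , 3768 , 3456 ⟩ ⟨ 11904 , 7552 , 3712 ⟩)
            (node ⟨ 4337 , 3896 , 12088 ⟩ ⟨ 12032 , 16184 , 3840 ⟩ ⟨ 4313 , 7936 , 16128 ⟩)))
        (node
          (node
            (node ⟨ 6388 , 14580 , 15013 ⟩ ⟨ 10476 , 2268 , 2284 ⟩ ⟨ 6364 , 2292 , 10484 ⟩)
            (node ⟨ 6772 , 6336 , 14528 ⟩ ⟨ 10860 , 2296 , 10488 ⟩ ⟨ 10432 , 14584 , 2240 ⟩)
            (node ⟨ 11049 , 6720 , 14912 ⟩ ⟨ 10560 , 2680 , 2368 ⟩ ⟨ 10816 , 6464 , 2624 ⟩))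
          (node
            (node ⟨ 4722 , 12914 , 362 ⟩ ⟨ 8810 , 370 , 8562 ⟩ ⟨ 4466 , 626 , 8818 ⟩)
            (node ⟨ 4310 , 4326 , 12518 ⟩ ⟨ 8398 , 703 , 206 ⟩ ⟨ 8422 , 214 , 230 ⟩)
            (node ⟨ 4338 , 12530 , 12902 ⟩ ⟨ 8426 , 218 , 234 ⟩ ⟨ 4314 , 242 , 8434 ⟩))
          (node
            (node ⟨ 6358 , 4672 , 12864 ⟩ ⟨ 8512 , 632 , 320 ⟩ ⟨ 8768 , 4416 , 576 ⟩)
            (node ⟨ 4340 , 12532 , 14950 ⟩ ⟨ 8428 , 220 , 236 ⟩ ⟨ 4316 , 244 , 8436 ⟩)
            (node ⟨ 4724 , 4288 , 12480 ⟩ ⟨ 8812 , 248 , 8440 ⟩ ⟨ 8384 , 12536 , 192 ⟩)))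
        (node
          (node
            (node ⟨ 6836 , 15028 , 2476 ⟩ ⟨ 10924 , 2484 , 10676 ⟩ ⟨ 6580 , 2740 , 10932 ⟩)
            (node ⟨ 11052 , 6784 , 14976 ⟩ ⟨ 10624 , 2744 , 2432 ⟩ ⟨ 10880 , 6528 , 2688 ⟩)
            (node ⟨ 5362 , 2872 , 11064 ⟩ ⟨ 11008 , 15160 , 2816 ⟩ ⟨ 5338 , 6912 , 15104 ⟩))
          (node
            (node ⟨ 9002 , 5696 , 13888 ⟩ ⟨ 9536 , 1656 , 1344 ⟩ ⟨ 9792 , 5440 , 1600 ⟩)
            (node ⟨ 5364 , 13556 , 12966 ⟩ ⟨ 9452 , 1244 , 1260 ⟩ ⟨ 5340 , 1268 , 9460 ⟩)
            (node ⟨ 5748 , 5312 , 13504 ⟩ ⟨ 9836 , 1272 , 9464 ⟩ ⟨ 9408 , 13560 , 1216 ⟩))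
          (node
            (node ⟨ 7412 , 824 , 9016 ⟩ ⟨ 8960 , 13112 , 768 ⟩ ⟨ 7388 , 4864 , 13056 ⟩)
            (node ⟨ 4788 , 7360 , 15552 ⟩ ⟨ 8876 , 3320 , 11512 ⟩ ⟨ 11456 , 15608 , 3264 ⟩)
            (node ⟨ 9004 , 4736 , 12928 ⟩ ⟨ 8576 , 696 , 384 ⟩ ⟨ 8832 , 4480 , 640 ⟩))))
      (node
        (node
          (node
            (node ⟨ 5170 , 13362 , 15077 ⟩ ⟨ 9258 , 1050 , 1066 ⟩ ⟨ 5146 , 1074 , 9266 ⟩)
            (node ⟨ 10126 , 15089 , 1934 ⟩ ⟨ 10150 , 1942 , 1958 ⟩ ⟨ 6038 , 6054 , 14246 ⟩)
            (node ⟨ 10154 , 1946 , 1962 ⟩ ⟨ 6042 , 1970 , 10162 ⟩ ⟨ 6066 , 14258 , 1062 ⟩))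
          (node
            (node ⟨ 12174 , 5120 , 13312 ⟩ ⟨ 12198 , 1080 , 9272 ⟩ ⟨ 9216 , 13368 , 1024 ⟩)
            (node ⟨ 10156 , 1948 , 1964 ⟩ ⟨ 6044 , 1972 , 10164 ⟩ ⟨ 6068 , 14260 , 3110 ⟩)
            (node ⟨ 5172 , 1976 , 10168 ⟩ ⟨ 10112 , 14264 , 1920 ⟩ ⟨ 5148 , 6016 , 14208 ⟩))
          (node
            (node ⟨ 12204 , 3996 , 4012 ⟩ ⟨ 8092 , 4020 , 12212 ⟩ ⟨ 8116 , 16308 , 2759 ⟩)
            (node ⟨ 7220 , 4024 , 12216 ⟩ ⟨ 12160 , 16312 , 3968 ⟩ ⟨ 7196 , 8064 , 16256 ⟩)
            (node ⟨ 4849 , 7168 , 15360 ⟩ ⟨ 8937 , 3128 , 11320 ⟩ ⟨ 11264 , 15416 , 3072 ⟩)))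
        (node
          (node
            (node ⟨ 6900 , 15092 , 2540 ⟩ ⟨ 10988 , 2548 , 10740 ⟩ ⟨ 6644 , 2804 , 10996 ⟩)
            (node ⟨ 11116 , 6848 , 15040 ⟩ ⟨ 10688 , 2808 , 2496 ⟩ ⟨ 10944 , 6592 , 2752 ⟩)
            (node ⟨ 6193 , 2936 , 11128 ⟩ ⟨ 11072 , 15224 , 2880 ⟩ ⟨ 6169 , 6976 , 15168 ⟩))
          (node
            (node ⟨ 9066 , 858 , 874 ⟩ ⟨ 4954 , 882 , 9074 ⟩ ⟨ 4978 , 13170 , 35 ⟩)
            (node ⟨ 4822 , 4838 , 13030 ⟩ ⟨ 8678 , 470 , 486 ⟩ ⟨ 8934 , 4582 , 742 ⟩)
            (node ⟨ 4850 , 13042 , 490 ⟩ ⟨ 8938 , 498 , 8690 ⟩ ⟨ 4594 , 754 , 8946 ⟩))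
          (node
            (node ⟨ 6870 , 888 , 9080 ⟩ ⟨ 9024 , 13176 , 832 ⟩ ⟨ 10982 , 4928 , 13120 ⟩)
            (node ⟨ 4852 , 13044 , 492 ⟩ ⟨ 8940 , 500 , 8692 ⟩ ⟨ 4596 , 756 , 8948 ⟩)
            (node ⟨ 9068 , 4800 , 12992 ⟩ ⟨ 8640 , 760 , 448 ⟩ ⟨ 8896 , 4544 , 704 ⟩)))
        (node
          (node
            (node ⟨ 11180 , 2972 , 2988 ⟩ ⟨ 7068 , 2996 , 11188 ⟩ ⟨ 7092 , 15284 , 1059 ⟩)
            (node ⟨ 6196 , 3000 , 11192 ⟩ ⟨ 11136 , 15288 , 2944 ⟩ ⟨ 6172 , 7040 , 15232 ⟩)
            (node ⟨ 5874 , 6144 , 14336 ⟩ ⟨ 9962 , 2104 , 10296 ⟩ ⟨ 10240 , 14392 , 2048 ⟩))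
          (node
            (node ⟨ 4146 , 1912 , 10104 ⟩ ⟨ 10048 , 14200 , 1856 ⟩ ⟨ 4122 , 5952 , 14144 ⟩)
            (node ⟨ 5876 , 14068 , 1516 ⟩ ⟨ 9964 , 1524 , 9716 ⟩ ⟨ 5620 , 1780 , 9972 ⟩)
            (node ⟨ 10092 , 5824 , 14016 ⟩ ⟨ 9664 , 1784 , 1472 ⟩ ⟨ 9920 , 5568 , 1728 ⟩))
          (node
            (node ⟨ 7924 , 4096 , 12288 ⟩ ⟨ 12012 , 56 , 8248 ⟩ ⟨ 8192 , 12344 , 0 ⟩)
            (node ⟨ 9132 , 7872 , 16064 ⟩ ⟨ 11712 , 3832 , 3520 ⟩ ⟨ 11968 , 7616 , 3776 ⟩)
            (node ⟨ 4148 , 952 , 9144 ⟩ ⟨ 9088 , 13240 , 896 ⟩ ⟨ 4124 , 4992 , 13184 ⟩))))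
      (node
        (node
          (node
            (node ⟨ 5682 , 13874 , 1322 ⟩ ⟨ 9770 , 1330 , 9522 ⟩ ⟨ 5426 , 1586 , 9778 ⟩)
            (node ⟨ 5270 , 5286 , 13478 ⟩ ⟨ 9358 , 3057 , 1166 ⟩ ⟨ 9382 , 1174 , 1190 ⟩)
            (node ⟨ 5298 , 13490 , 13862 ⟩ ⟨ 9386 , 1178 , 1194 ⟩ ⟨ 5274 , 1202 , 9394 ⟩))
          (node
            (node ⟨ 7318 , 5632 , 13824 ⟩ ⟨ 9472 , 1592 , 1280 ⟩ ⟨ 9728 , 5376 , 1536 ⟩)
            (node ⟨ 5300 , 13492 , 15910 ⟩ ⟨ 9388 , 1180 , 1196 ⟩ ⟨ 5276 , 1204 , 9396 ⟩)
            (node ⟨ 5684 , 5248 , 13440 ⟩ ⟨ 9772 , 1208 , 9400 ⟩ ⟨ 9344 , 13496 , 1152 ⟩))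
          (node
            (node ⟨ 7348 , 15540 , 11263 ⟩ ⟨ 11436 , 3228 , 3244 ⟩ ⟨ 7324 , 3252 , 11444 ⟩)
            (node ⟨ 7732 , 7296 , 15488 ⟩ ⟨ 11820 , 3256 , 11448 ⟩ ⟨ 11392 , 15544 , 3200 ⟩)
            (node ⟨ 9193 , 7680 , 15872 ⟩ ⟨ 11520 , 3640 , 3328 ⟩ ⟨ 11776 , 7424 , 3584 ⟩)))
        (node
          (node
            (node ⟨ 11244 , 3036 , 3052 ⟩ ⟨ 7132 , 3060 , 11252 ⟩ ⟨ 7156 , 15348 , 2213 ⟩)
            (node ⟨ 6260 , 3064 , 11256 ⟩ ⟨ 11200 , 15352 , 3008 ⟩ ⟨ 6236 , 7104 , 15296 ⟩)
            (node ⟨ 6705 , 6208 , 14400 ⟩ ⟨ 10793 , 2168 , 10360 ⟩ ⟨ 10304 , 14456 , 2112 ⟩))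
          (node
            (node ⟨ 4210 , 12402 , 12835 ⟩ ⟨ 8298 , 90 , 106 ⟩ ⟨ 4186 , 114 , 8306 ⟩)
            (node ⟨ 9166 , 4231 , 974 ⟩ ⟨ 9190 , 982 , 998 ⟩ ⟨ 5078 , 5094 , 13286 ⟩)
            (node ⟨ 9194 , 986 , 1002 ⟩ ⟨ 5082 , 1010 , 9202 ⟩ ⟨ 5106 , 13298 , 102 ⟩))
          (node
            (node ⟨ 11214 , 4160 , 12352 ⟩ ⟨ 11238 , 120 , 8312 ⟩ ⟨ 8256 , 12408 , 64 ⟩)
            (node ⟨ 9196 , 988 , 1004 ⟩ ⟨ 5084 , 1012 , 9204 ⟩ ⟨ 5108 , 13300 , 2150 ⟩)
            (node ⟨ 4212 , 1016 , 9208 ⟩ ⟨ 9152 , 13304 , 960 ⟩ ⟨ 4188 , 5056 , 13248 ⟩)))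
        (node
          (node
            (node ⟨ 6324 , 14516 , 13859 ⟩ ⟨ 10412 , 2204 , 2220 ⟩ ⟨ 6300 , 2228 , 10420 ⟩)
            (node ⟨ 6708 , 6272 , 14464 ⟩ ⟨ 10796 , 2232 , 10424 ⟩ ⟨ 10368 , 14520 , 2176 ⟩)
            (node ⟨ 10218 , 6656 , 14848 ⟩ ⟨ 10496 , 2616 , 2304 ⟩ ⟨ 10752 , 6400 , 2560 ⟩))
          (node
            (node ⟨ 4658 , 5184 , 13376 ⟩ ⟨ 8746 , 1144 , 9336 ⟩ ⟨ 9280 , 13432 , 1088 ⟩)
            (node ⟨ 10220 , 2012 , 2028 ⟩ ⟨ 6108 , 2036 , 10228 ⟩ ⟨ 6132 , 14324 , 166 ⟩)
            (node ⟨ 5236 , 2040 , 10232 ⟩ ⟨ 10176 , 14328 , 1984 ⟩ ⟨ 5212 , 6080 , 14272 ⟩))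
          (node
            (node ⟨ 12268 , 4608 , 12800 ⟩ ⟨ 8448 , 568 , 256 ⟩ ⟨ 8704 , 4352 , 512 ⟩)
            (node ⟨ 4276 , 4088 , 12280 ⟩ ⟨ 12224 , 16376 , 4032 ⟩ ⟨ 4252 , 8128 , 16320 ⟩)
            (node ⟨ 4660 , 4224 , 12416 ⟩ ⟨ 8748 , 184 , 8376 ⟩ ⟨ 8320 , 12472 , 128 ⟩)))))
    (node
      (node
        (node
          (node
            (node ⟨ 6389 , 1850 , 10042 ⟩ ⟨ 9986 , 14138 , 1794 ⟩ ⟨ 6365 , 5890 , 14082 ⟩)
            (node ⟨ 5814 , 14006 , 1454 ⟩ ⟨ 9902 , 1462 , 9654 ⟩ ⟨ 5558 , 1718 , 9910 ⟩)
            (node ⟨ 10030 , 5762 , 13954 ⟩ ⟨ 9602 , 1722 , 1410 ⟩ ⟨ 9858 , 5506 , 1666 ⟩))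
          (node
            (node ⟨ 9992 , 16054 , 1800 ⟩ ⟨ 10016 , 1808 , 1824 ⟩ ⟨ 5904 , 5920 , 14112 ⟩)
            (node ⟨ 12078 , 5764 , 13956 ⟩ ⟨ 9604 , 1724 , 1412 ⟩ ⟨ 9860 , 5508 , 1668 ⟩)
            (node ⟨ 5776 , 5792 , 13984 ⟩ ⟨ 9632 , 1424 , 1440 ⟩ ⟨ 9888 , 5536 , 1696 ⟩))
          (node
            (node ⟨ 6359 , 7812 , 16004 ⟩ ⟨ 11652 , 3772 , 3460 ⟩ ⟨ 11908 , 7556 , 3716 ⟩)
            (node ⟨ 7824 , 7840 , 16032 ⟩ ⟨ 11680 , 3472 , 3488 ⟩ ⟨ 11936 , 7584 , 3744 ⟩)
            (node ⟨ 12040 , 4289 , 3848 ⟩ ⟨ 12064 , 3856 , 3872 ⟩ ⟨ 7952 , 7968 , 16160 ⟩)))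
        (node
          (node
            (node ⟨ 6837 , 6340 , 14532 ⟩ ⟨ 10925 , 2300 , 10492 ⟩ ⟨ 10436 , 14588 , 2244 ⟩)
            (node ⟨ 6352 , 6368 , 14560 ⟩ ⟨ 10440 , 2684 , 2248 ⟩ ⟨ 10464 , 2256 , 2272 ⟩)
            (node ⟨ 6736 , 6752 , 14944 ⟩ ⟨ 10592 , 2384 , 2400 ⟩ ⟨ 10848 , 6496 , 2656 ⟩))
          (node
            (node ⟨ 9003 , 4674 , 12866 ⟩ ⟨ 8514 , 634 , 322 ⟩ ⟨ 8770 , 4418 , 578 ⟩)
            (node ⟨ 4342 , 12534 , 12967 ⟩ ⟨ 8430 , 222 , 238 ⟩ ⟨ 4318 , 246 , 8438 ⟩)
            (node ⟨ 4726 , 4290 , 12482 ⟩ ⟨ 8814 , 250 , 8442 ⟩ ⟨ 8386 , 12538 , 194 ⟩))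
          (node
            (node ⟨ 4688 , 4704 , 12896 ⟩ ⟨ 8544 , 336 , 352 ⟩ ⟨ 8800 , 4448 , 608 ⟩)
            (node ⟨ 6774 , 4292 , 12484 ⟩ ⟨ 10862 , 252 , 8444 ⟩ ⟨ 8388 , 12540 , 196 ⟩)
            (node ⟨ 4304 , 4320 , 12512 ⟩ ⟨ 8392 , 636 , 200 ⟩ ⟨ 8416 , 208 , 224 ⟩)))
        (node
          (node
            (node ⟨ 10027 , 6788 , 14980 ⟩ ⟨ 10628 , 2748 , 2436 ⟩ ⟨ 10884 , 6532 , 2692 ⟩)
            (node ⟨ 6800 , 6816 , 15008 ⟩ ⟨ 10656 , 2448 , 2464 ⟩ ⟨ 10912 , 6560 , 2720 ⟩)
            (node ⟨ 11016 , 5314 , 2824 ⟩ ⟨ 11040 , 2832 , 2848 ⟩ ⟨ 6928 , 6944 , 15136 ⟩))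
          (node
            (node ⟨ 5712 , 5728 , 13920 ⟩ ⟨ 9568 , 1360 , 1376 ⟩ ⟨ 9824 , 5472 , 1632 ⟩)
            (node ⟨ 4790 , 5316 , 13508 ⟩ ⟨ 8878 , 1276 , 9468 ⟩ ⟨ 9412 , 13564 , 1220 ⟩)
            (node ⟨ 5328 , 5344 , 13536 ⟩ ⟨ 9416 , 1660 , 1224 ⟩ ⟨ 9440 , 1232 , 1248 ⟩))
          (node
            (node ⟨ 8968 , 7364 , 776 ⟩ ⟨ 8992 , 784 , 800 ⟩ ⟨ 4880 , 4896 , 13088 ⟩)
            (node ⟨ 7376 , 7392 , 15584 ⟩ ⟨ 11464 , 700 , 3272 ⟩ ⟨ 11488 , 3280 , 3296 ⟩)
            (node ⟨ 4752 , 4768 , 12960 ⟩ ⟨ 8608 , 400 , 416 ⟩ ⟨ 8864 , 4512 , 672 ⟩))))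
      (node
        (node
          (node
            (node ⟨ 6901 , 5122 , 13314 ⟩ ⟨ 10989 , 1082 , 9274 ⟩ ⟨ 9218 , 13370 , 1026 ⟩)
            (node ⟨ 10158 , 1950 , 1966 ⟩ ⟨ 6046 , 1974 , 10166 ⟩ ⟨ 6070 , 14262 , 2753 ⟩)
            (node ⟨ 5174 , 1978 , 10170 ⟩ ⟨ 10114 , 14266 , 1922 ⟩ ⟨ 5150 , 6018 , 14210 ⟩))
          (node
            (node ⟨ 5136 , 5152 , 13344 ⟩ ⟨ 9224 , 4022 , 1032 ⟩ ⟨ 9248 , 1040 , 1056 ⟩)
            (node ⟨ 7222 , 1980 , 10172 ⟩ ⟨ 10116 , 14268 , 1924 ⟩ ⟨ 7198 , 6020 , 14212 ⟩)
            (node ⟨ 10120 , 5124 , 1928 ⟩ ⟨ 10144 , 1936 , 1952 ⟩ ⟨ 6032 , 6048 , 14240 ⟩))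
          (node
            (node ⟨ 6871 , 4028 , 12220 ⟩ ⟨ 12164 , 16316 , 3972 ⟩ ⟨ 10983 , 8068 , 16260 ⟩)
            (node ⟨ 12168 , 7172 , 3976 ⟩ ⟨ 12192 , 3984 , 4000 ⟩ ⟨ 8080 , 8096 , 16288 ⟩)
            (node ⟨ 7184 , 7200 , 15392 ⟩ ⟨ 11272 , 761 , 3080 ⟩ ⟨ 11296 , 3088 , 3104 ⟩)))
        (node
          (node
            (node ⟨ 11181 , 6852 , 15044 ⟩ ⟨ 10692 , 2812 , 2500 ⟩ ⟨ 10948 , 6596 , 2756 ⟩)
            (node ⟨ 6864 , 6880 , 15072 ⟩ ⟨ 10720 , 2512 , 2528 ⟩ ⟨ 10976 , 6624 , 2784 ⟩)
            (node ⟨ 11080 , 6145 , 2888 ⟩ ⟨ 11104 , 2896 , 2912 ⟩ ⟨ 6992 , 7008 , 15200 ⟩))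
          (node
            (node ⟨ 4147 , 890 , 9082 ⟩ ⟨ 9026 , 13178 , 834 ⟩ ⟨ 4123 , 4930 , 13122 ⟩)
            (node ⟨ 4854 , 13046 , 494 ⟩ ⟨ 8942 , 502 , 8694 ⟩ ⟨ 4598 , 758 , 8950 ⟩)
            (node ⟨ 9070 , 4802 , 12994 ⟩ ⟨ 8642 , 762 , 450 ⟩ ⟨ 8898 , 4546 , 706 ⟩))
          (node
            (node ⟨ 9032 , 15094 , 840 ⟩ ⟨ 9056 , 848 , 864 ⟩ ⟨ 4944 , 4960 , 13152 ⟩)
            (node ⟨ 11118 , 4804 , 12996 ⟩ ⟨ 8644 , 764 , 452 ⟩ ⟨ 8900 , 4548 , 708 ⟩)
            (node ⟨ 4816 , 4832 , 13024 ⟩ ⟨ 8672 , 464 , 480 ⟩ ⟨ 8928 , 4576 , 736 ⟩)))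
        (node
          (node
            (node ⟨ 5171 , 3004 , 11196 ⟩ ⟨ 11140 , 15292 , 2948 ⟩ ⟨ 5147 , 7044 , 15236 ⟩)
            (node ⟨ 11144 , 6148 , 2952 ⟩ ⟨ 11168 , 2960 , 2976 ⟩ ⟨ 7056 , 7072 , 15264 ⟩)
            (node ⟨ 6160 , 6176 , 14368 ⟩ ⟨ 10248 , 1786 , 2056 ⟩ ⟨ 10272 , 2064 , 2080 ⟩))
          (node
            (node ⟨ 10056 , 4098 , 1864 ⟩ ⟨ 10080 , 1872 , 1888 ⟩ ⟨ 5968 , 5984 , 14176 ⟩)
            (node ⟨ 9134 , 5828 , 14020 ⟩ ⟨ 9668 , 1788 , 1476 ⟩ ⟨ 9924 , 5572 , 1732 ⟩)
            (node ⟨ 5840 , 5856 , 14048 ⟩ ⟨ 9696 , 1488 , 1504 ⟩ ⟨ 9952 , 5600 , 1760 ⟩))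
          (node
            (node ⟨ 4112 , 4128 , 12320 ⟩ ⟨ 8200 , 3836 , 8 ⟩ ⟨ 8224 , 16 , 32 ⟩)
            (node ⟨ 7888 , 7904 , 16096 ⟩ ⟨ 11744 , 3536 , 3552 ⟩ ⟨ 12000 , 7648 , 3808 ⟩)
            (node ⟨ 9096 , 4100 , 904 ⟩ ⟨ 9120 , 912 , 928 ⟩ ⟨ 5008 , 5024 , 13216 ⟩))))
      (node
        (node
          (node
            (node ⟨ 11245 , 5634 , 13826 ⟩ ⟨ 9474 , 1594 , 1282 ⟩ ⟨ 9730 , 5378 , 1538 ⟩)
            (node ⟨ 5302 , 13494 , 11257 ⟩ ⟨ 9390 , 1182 , 1198 ⟩ ⟨ 5278 , 1206 , 9398 ⟩)
            (node ⟨ 5686 , 5250 , 13442 ⟩ ⟨ 9774 , 1210 , 9402 ⟩ ⟨ 9346 , 13498 , 1154 ⟩))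
          (node
            (node ⟨ 5648 , 5664 , 13856 ⟩ ⟨ 9504 , 1296 , 1312 ⟩ ⟨ 9760 , 5408 , 1568 ⟩)
            (node ⟨ 7734 , 5252 , 13444 ⟩ ⟨ 11822 , 1212 , 9404 ⟩ ⟨ 9348 , 13500 , 1156 ⟩)
            (node ⟨ 5264 , 5280 , 13472 ⟩ ⟨ 9352 , 1596 , 1160 ⟩ ⟨ 9376 , 1168 , 1184 ⟩))
          (node
            (node ⟨ 11215 , 7300 , 15492 ⟩ ⟨ 11239 , 3260 , 11452 ⟩ ⟨ 11396 , 15548 , 3204 ⟩)
            (node ⟨ 7312 , 7328 , 15520 ⟩ ⟨ 11400 , 3644 , 3208 ⟩ ⟨ 11424 , 3216 , 3232 ⟩)
            (node ⟨ 7696 , 7712 , 15904 ⟩ ⟨ 11552 , 3344 , 3360 ⟩ ⟨ 11808 , 7456 , 3616 ⟩)))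
        (node
          (node
            (node ⟨ 6325 , 3068 , 11260 ⟩ ⟨ 11204 , 15356 , 3012 ⟩ ⟨ 6301 , 7108 , 15300 ⟩)
            (node ⟨ 11208 , 6212 , 3016 ⟩ ⟨ 11232 , 3024 , 3040 ⟩ ⟨ 7120 , 7136 , 15328 ⟩)
            (node ⟨ 6224 , 6240 , 14432 ⟩ ⟨ 10312 , 2617 , 2120 ⟩ ⟨ 10336 , 2128 , 2144 ⟩))
          (node
            (node ⟨ 4659 , 4162 , 12354 ⟩ ⟨ 8747 , 122 , 8314 ⟩ ⟨ 8258 , 12410 , 66 ⟩)
            (node ⟨ 9198 , 990 , 1006 ⟩ ⟨ 5086 , 1014 , 9206 ⟩ ⟨ 5110 , 13302 , 167 ⟩)
            (node ⟨ 4214 , 1018 , 9210 ⟩ ⟨ 9154 , 13306 , 962 ⟩ ⟨ 4190 , 5058 , 13250 ⟩))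
          (node
            (node ⟨ 4176 , 4192 , 12384 ⟩ ⟨ 8264 , 3062 , 72 ⟩ ⟨ 8288 , 80 , 96 ⟩)
            (node ⟨ 6262 , 1020 , 9212 ⟩ ⟨ 9156 , 13308 , 964 ⟩ ⟨ 6238 , 5060 , 13252 ⟩)
            (node ⟨ 9160 , 4164 , 968 ⟩ ⟨ 9184 , 976 , 992 ⟩ ⟨ 5072 , 5088 , 13280 ⟩)))
        (node
          (node
            (node ⟨ 5683 , 6276 , 14468 ⟩ ⟨ 9771 , 2236 , 10428 ⟩ ⟨ 10372 , 14524 , 2180 ⟩)
            (node ⟨ 6288 , 6304 , 14496 ⟩ ⟨ 10376 , 2620 , 2184 ⟩ ⟨ 10400 , 2192 , 2208 ⟩)
            (node ⟨ 6672 , 6688 , 14880 ⟩ ⟨ 10528 , 2320 , 2336 ⟩ ⟨ 10784 , 6432 , 2592 ⟩))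
          (node
            (node ⟨ 5200 , 5216 , 13408 ⟩ ⟨ 9288 , 570 , 1096 ⟩ ⟨ 9312 , 1104 , 1120 ⟩)
            (node ⟨ 4278 , 2044 , 10236 ⟩ ⟨ 10180 , 14332 , 1988 ⟩ ⟨ 4254 , 6084 , 14276 ⟩)
            (node ⟨ 10184 , 5188 , 1992 ⟩ ⟨ 10208 , 2000 , 2016 ⟩ ⟨ 6096 , 6112 , 14304 ⟩))
          (node
            (node ⟨ 4624 , 4640 , 12832 ⟩ ⟨ 8480 , 272 , 288 ⟩ ⟨ 8736 , 4384 , 544 ⟩)
            (node ⟨ 12232 , 4228 , 4040 ⟩ ⟨ 12256 , 4048 , 4064 ⟩ ⟨ 8144 , 8160 , 16352 ⟩)
            (node ⟨ 4240 , 4256 , 12448 ⟩ ⟨ 8328 , 572 , 136 ⟩ ⟨ 8352 , 144 , 160 ⟩)))))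
    (node
      (node
        (node
          (node
            (node ⟨ 9994 , 6341 , 1802 ⟩ ⟨ 10018 , 1810 , 1826 ⟩ ⟨ 5906 , 5922 , 14114 ⟩)
            (node ⟨ 6353 , 5766 , 13958 ⟩ ⟨ 9606 , 1726 , 1414 ⟩ ⟨ 9862 , 5510 , 1670 ⟩)
            (node ⟨ 5778 , 5794 , 13986 ⟩ ⟨ 9634 , 1426 , 1442 ⟩ ⟨ 9890 , 5538 , 1698 ⟩))
          (node
            (node ⟨ 10024 , 1816 , 1832 ⟩ ⟨ 5912 , 1840 , 10032 ⟩ ⟨ 5936 , 14128 , 3718 ⟩)
            (node ⟨ 5780 , 5796 , 13988 ⟩ ⟨ 9636 , 1428 , 1444 ⟩ ⟨ 9892 , 5540 , 1700 ⟩)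
            (node ⟨ 5808 , 14000 , 1448 ⟩ ⟨ 9896 , 1456 , 9648 ⟩ ⟨ 5552 , 1712 , 9904 ⟩))
          (node
            (node ⟨ 7828 , 7844 , 16036 ⟩ ⟨ 11684 , 3476 , 3492 ⟩ ⟨ 11940 , 7588 , 3748 ⟩)
            (node ⟨ 7856 , 16048 , 3496 ⟩ ⟨ 11944 , 3504 , 11696 ⟩ ⟨ 7600 , 3760 , 11952 ⟩)
            (node ⟨ 12072 , 3864 , 3880 ⟩ ⟨ 7960 , 3888 , 12080 ⟩ ⟨ 7984 , 16176 , 225 ⟩)))
        (node
          (node
            (node ⟨ 6356 , 6372 , 14564 ⟩ ⟨ 10444 , 2749 , 2252 ⟩ ⟨ 10468 , 2260 , 2276 ⟩)
            (node ⟨ 6384 , 14576 , 14948 ⟩ ⟨ 10472 , 2264 , 2280 ⟩ ⟨ 6360 , 2288 , 10480 ⟩)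
            (node ⟨ 6768 , 14960 , 2408 ⟩ ⟨ 10856 , 2416 , 10608 ⟩ ⟨ 6512 , 2672 , 10864 ⟩))
          (node
            (node ⟨ 4690 , 4706 , 12898 ⟩ ⟨ 8546 , 338 , 354 ⟩ ⟨ 8802 , 4450 , 610 ⟩)
            (node ⟨ 4791 , 4294 , 12486 ⟩ ⟨ 8879 , 254 , 8446 ⟩ ⟨ 8390 , 12542 , 198 ⟩)
            (node ⟨ 4306 , 4322 , 12514 ⟩ ⟨ 8394 , 638 , 202 ⟩ ⟨ 8418 , 210 , 226 ⟩))
          (node
            (node ⟨ 4720 , 12912 , 360 ⟩ ⟨ 8808 , 368 , 8560 ⟩ ⟨ 4464 , 624 , 8816 ⟩)
            (node ⟨ 4308 , 4324 , 12516 ⟩ ⟨ 8396 , 2686 , 204 ⟩ ⟨ 8420 , 212 , 228 ⟩)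
            (node ⟨ 4336 , 12528 , 12900 ⟩ ⟨ 8424 , 216 , 232 ⟩ ⟨ 4312 , 240 , 8432 ⟩)))
        (node
          (node
            (node ⟨ 6804 , 6820 , 15012 ⟩ ⟨ 10660 , 2452 , 2468 ⟩ ⟨ 10916 , 6564 , 2724 ⟩)
            (node ⟨ 6832 , 15024 , 2472 ⟩ ⟨ 10920 , 2480 , 10672 ⟩ ⟨ 6576 , 2736 , 10928 ⟩)
            (node ⟨ 11048 , 2840 , 2856 ⟩ ⟨ 6936 , 2864 , 11056 ⟩ ⟨ 6960 , 15152 , 1250 ⟩))
          (node
            (node ⟨ 5744 , 13936 , 1384 ⟩ ⟨ 9832 , 1392 , 9584 ⟩ ⟨ 5488 , 1648 , 9840 ⟩)
            (node ⟨ 5332 , 5348 , 13540 ⟩ ⟨ 9420 , 702 , 1228 ⟩ ⟨ 9444 , 1236 , 1252 ⟩)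
            (node ⟨ 5360 , 13552 , 13924 ⟩ ⟨ 9448 , 1240 , 1256 ⟩ ⟨ 5336 , 1264 , 9456 ⟩))
          (node
            (node ⟨ 9000 , 792 , 808 ⟩ ⟨ 4888 , 816 , 9008 ⟩ ⟨ 4912 , 13104 , 3300 ⟩)
            (node ⟨ 7408 , 15600 , 12964 ⟩ ⟨ 11496 , 3288 , 3304 ⟩ ⟨ 7384 , 3312 , 11504 ⟩)
            (node ⟨ 4784 , 12976 , 424 ⟩ ⟨ 8872 , 432 , 8624 ⟩ ⟨ 4528 , 688 , 8880 ⟩))))
      (node
        (node
          (node
            (node ⟨ 5138 , 5154 , 13346 ⟩ ⟨ 9226 , 2813 , 1034 ⟩ ⟨ 9250 , 1042 , 1058 ⟩)
            (node ⟨ 6865 , 1982 , 10174 ⟩ ⟨ 10118 , 14270 , 1926 ⟩ ⟨ 10977 , 6022 , 14214 ⟩)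
            (node ⟨ 10122 , 5126 , 1930 ⟩ ⟨ 10146 , 1938 , 1954 ⟩ ⟨ 6034 , 6050 , 14242 ⟩))
          (node
            (node ⟨ 5168 , 13360 , 12222 ⟩ ⟨ 9256 , 1048 , 1064 ⟩ ⟨ 5144 , 1072 , 9264 ⟩)
            (node ⟨ 10124 , 7174 , 1932 ⟩ ⟨ 10148 , 1940 , 1956 ⟩ ⟨ 6036 , 6052 , 14244 ⟩)
            (node ⟨ 10152 , 1944 , 1960 ⟩ ⟨ 6040 , 1968 , 10160 ⟩ ⟨ 6064 , 14256 , 1060 ⟩))
          (node
            (node ⟨ 12172 , 15095 , 3980 ⟩ ⟨ 12196 , 3988 , 4004 ⟩ ⟨ 8084 , 8100 , 16292 ⟩)
            (node ⟨ 12200 , 3992 , 4008 ⟩ ⟨ 8088 , 4016 , 12208 ⟩ ⟨ 8112 , 16304 , 3108 ⟩)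
            (node ⟨ 7216 , 15408 , 13025 ⟩ ⟨ 11304 , 3096 , 3112 ⟩ ⟨ 7192 , 3120 , 11312 ⟩)))
        (node
          (node
            (node ⟨ 6868 , 6884 , 15076 ⟩ ⟨ 10724 , 2516 , 2532 ⟩ ⟨ 10980 , 6628 , 2788 ⟩)
            (node ⟨ 6896 , 15088 , 2536 ⟩ ⟨ 10984 , 2544 , 10736 ⟩ ⟨ 6640 , 2800 , 10992 ⟩)
            (node ⟨ 11112 , 2904 , 2920 ⟩ ⟨ 7000 , 2928 , 11120 ⟩ ⟨ 7024 , 15216 , 2081 ⟩))
          (node
            (node ⟨ 9034 , 4099 , 842 ⟩ ⟨ 9058 , 850 , 866 ⟩ ⟨ 4946 , 4962 , 13154 ⟩)
            (node ⟨ 9135 , 4806 , 12998 ⟩ ⟨ 8646 , 766 , 454 ⟩ ⟨ 8902 , 4550 , 710 ⟩)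
            (node ⟨ 4818 , 4834 , 13026 ⟩ ⟨ 8674 , 466 , 482 ⟩ ⟨ 8930 , 4578 , 738 ⟩))
          (node
            (node ⟨ 9064 , 856 , 872 ⟩ ⟨ 4952 , 880 , 9072 ⟩ ⟨ 4976 , 13168 , 2758 ⟩)
            (node ⟨ 4820 , 4836 , 13028 ⟩ ⟨ 8676 , 468 , 484 ⟩ ⟨ 8932 , 4580 , 740 ⟩)
            (node ⟨ 4848 , 13040 , 488 ⟩ ⟨ 8936 , 496 , 8688 ⟩ ⟨ 4592 , 752 , 8944 ⟩)))
        (node
          (node
            (node ⟨ 11148 , 5123 , 2956 ⟩ ⟨ 11172 , 2964 , 2980 ⟩ ⟨ 7060 , 7076 , 15268 ⟩)
            (node ⟨ 11176 , 2968 , 2984 ⟩ ⟨ 7064 , 2992 , 11184 ⟩ ⟨ 7088 , 15280 , 2084 ⟩)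
            (node ⟨ 6192 , 14384 , 14050 ⟩ ⟨ 10280 , 2072 , 2088 ⟩ ⟨ 6168 , 2096 , 10288 ⟩))
          (node
            (node ⟨ 10088 , 1880 , 1896 ⟩ ⟨ 5976 , 1904 , 10096 ⟩ ⟨ 6000 , 14192 , 34 ⟩)
            (node ⟨ 5844 , 5860 , 14052 ⟩ ⟨ 9700 , 1492 , 1508 ⟩ ⟨ 9956 , 5604 , 1764 ⟩)
            (node ⟨ 5872 , 14064 , 1512 ⟩ ⟨ 9960 , 1520 , 9712 ⟩ ⟨ 5616 , 1776 , 9968 ⟩))
          (node
            (node ⟨ 4144 , 12336 , 16100 ⟩ ⟨ 8232 , 24 , 40 ⟩ ⟨ 4120 , 48 , 8240 ⟩)
            (node ⟨ 7920 , 16112 , 3560 ⟩ ⟨ 12008 , 3568 , 11760 ⟩ ⟨ 7664 , 3824 , 12016 ⟩)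
            (node ⟨ 9128 , 920 , 936 ⟩ ⟨ 5016 , 944 , 9136 ⟩ ⟨ 5040 , 13232 , 36 ⟩))))
      (node
        (node
          (node
            (node ⟨ 5650 , 5666 , 13858 ⟩ ⟨ 9506 , 1298 , 1314 ⟩ ⟨ 9762 , 5410 , 1570 ⟩)
            (node ⟨ 11209 , 5254 , 13446 ⟩ ⟨ 11233 , 1214 , 9406 ⟩ ⟨ 9350 , 13502 , 1158 ⟩)
            (node ⟨ 5266 , 5282 , 13474 ⟩ ⟨ 9354 , 1598 , 1162 ⟩ ⟨ 9378 , 1170 , 1186 ⟩))
          (node
            (node ⟨ 5680 , 13872 , 1320 ⟩ ⟨ 9768 , 1328 , 9520 ⟩ ⟨ 5424 , 1584 , 9776 ⟩)
            (node ⟨ 5268 , 5284 , 13476 ⟩ ⟨ 9356 , 3646 , 1164 ⟩ ⟨ 9380 , 1172 , 1188 ⟩)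
            (node ⟨ 5296 , 13488 , 13860 ⟩ ⟨ 9384 , 1176 , 1192 ⟩ ⟨ 5272 , 1200 , 9392 ⟩))
          (node
            (node ⟨ 7316 , 7332 , 15524 ⟩ ⟨ 11404 , 3063 , 3212 ⟩ ⟨ 11428 , 3220 , 3236 ⟩)
            (node ⟨ 7344 , 15536 , 15908 ⟩ ⟨ 11432 , 3224 , 3240 ⟩ ⟨ 7320 , 3248 , 11440 ⟩)
            (node ⟨ 7728 , 15920 , 3368 ⟩ ⟨ 11816 , 3376 , 11568 ⟩ ⟨ 7472 , 3632 , 11824 ⟩)))
        (node
          (node
            (node ⟨ 11212 , 6277 , 3020 ⟩ ⟨ 11236 , 3028 , 3044 ⟩ ⟨ 7124 , 7140 , 15332 ⟩)
            (node ⟨ 11240 , 3032 , 3048 ⟩ ⟨ 7128 , 3056 , 11248 ⟩ ⟨ 7152 , 15344 , 2148 ⟩)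
            (node ⟨ 6256 , 14448 , 14881 ⟩ ⟨ 10344 , 2136 , 2152 ⟩ ⟨ 6232 , 2160 , 10352 ⟩))
          (node
            (node ⟨ 4178 , 4194 , 12386 ⟩ ⟨ 8266 , 571 , 74 ⟩ ⟨ 8290 , 82 , 98 ⟩)
            (node ⟨ 4279 , 1022 , 9214 ⟩ ⟨ 9158 , 13310 , 966 ⟩ ⟨ 4255 , 5062 , 13254 ⟩)
            (node ⟨ 9162 , 4166 , 970 ⟩ ⟨ 9186 , 978 , 994 ⟩ ⟨ 5074 , 5090 , 13282 ⟩))
          (node
            (node ⟨ 4208 , 12400 , 11262 ⟩ ⟨ 8296 , 88 , 104 ⟩ ⟨ 4184 , 112 , 8304 ⟩)
            (node ⟨ 9164 , 6214 , 972 ⟩ ⟨ 9188 , 980 , 996 ⟩ ⟨ 5076 , 5092 , 13284 ⟩)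
            (node ⟨ 9192 , 984 , 1000 ⟩ ⟨ 5080 , 1008 , 9200 ⟩ ⟨ 5104 , 13296 , 100 ⟩)))
        (node
          (node
            (node ⟨ 6292 , 6308 , 14500 ⟩ ⟨ 10380 , 1595 , 2188 ⟩ ⟨ 10404 , 2196 , 2212 ⟩)
            (node ⟨ 6320 , 14512 , 14884 ⟩ ⟨ 10408 , 2200 , 2216 ⟩ ⟨ 6296 , 2224 , 10416 ⟩)
            (node ⟨ 6704 , 14896 , 2344 ⟩ ⟨ 10792 , 2352 , 10544 ⟩ ⟨ 6448 , 2608 , 10800 ⟩))
          (node
            (node ⟨ 5232 , 13424 , 12834 ⟩ ⟨ 9320 , 1112 , 1128 ⟩ ⟨ 5208 , 1136 , 9328 ⟩)
            (node ⟨ 10188 , 4230 , 1996 ⟩ ⟨ 10212 , 2004 , 2020 ⟩ ⟨ 6100 , 6116 , 14308 ⟩)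
            (node ⟨ 10216 , 2008 , 2024 ⟩ ⟨ 6104 , 2032 , 10224 ⟩ ⟨ 6128 , 14320 , 1124 ⟩))
          (node
            (node ⟨ 4656 , 12848 , 296 ⟩ ⟨ 8744 , 304 , 8496 ⟩ ⟨ 4400 , 560 , 8752 ⟩)
            (node ⟨ 12264 , 4056 , 4072 ⟩ ⟨ 8152 , 4080 , 12272 ⟩ ⟨ 8176 , 16368 , 164 ⟩)
            (node ⟨ 4272 , 12464 , 12836 ⟩ ⟨ 8360 , 152 , 168 ⟩ ⟨ 4248 , 176 , 8368 ⟩)))))

certificateD : Table ℕ 7
certificateD =
  node
    (node
      (node
        (node
          (node
            (node ⟨ 5378 , 5634 , 13826 ⟩ ⟨ 9346 , 2941 , 1154 ⟩ ⟨ 9730 , 1282 , 1538 ⟩)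
            (node ⟨ 7009 , 2014 , 10206 ⟩ ⟨ 9310 , 14302 , 1118 ⟩ ⟨ 6625 , 5214 , 13406 ⟩)
            (node ⟨ 9374 , 5186 , 13378 ⟩ ⟨ 9758 , 1986 , 10178 ⟩ ⟨ 9282 , 14274 , 1090 ⟩))
          (node
            (node ⟨ 5392 , 5648 , 13840 ⟩ ⟨ 9360 , 1288 , 1168 ⟩ ⟨ 9744 , 1296 , 1552 ⟩)
            (node ⟨ 11422 , 5188 , 13380 ⟩ ⟨ 11806 , 1988 , 10180 ⟩ ⟨ 9284 , 14276 , 1092 ⟩)
            (node ⟨ 5380 , 5200 , 13392 ⟩ ⟨ 9288 , 2000 , 10192 ⟩ ⟨ 9296 , 14288 , 1104 ⟩))
          (node
            (node ⟨ 7031 , 7236 , 15428 ⟩ ⟨ 10999 , 4036 , 12228 ⟩ ⟨ 11332 , 16324 , 3140 ⟩)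
            (node ⟨ 7428 , 7248 , 15440 ⟩ ⟨ 11336 , 4048 , 12240 ⟩ ⟨ 11344 , 16336 , 3152 ⟩)
            (node ⟨ 7440 , 7696 , 15888 ⟩ ⟨ 11408 , 3336 , 3216 ⟩ ⟨ 11792 , 3344 , 3600 ⟩)))
        (node
          (node
            (node ⟨ 7012 , 15204 , 11229 ⟩ ⟨ 10980 , 2532 , 2788 ⟩ ⟨ 6628 , 2916 , 11108 ⟩)
            (node ⟨ 7024 , 15216 , 2792 ⟩ ⟨ 10992 , 2544 , 2800 ⟩ ⟨ 6640 , 2928 , 11120 ⟩)
            (node ⟨ 6401 , 6192 , 14384 ⟩ ⟨ 10280 , 2992 , 11184 ⟩ ⟨ 10288 , 15280 , 2096 ⟩))
          (node
            (node ⟨ 8347 , 4130 , 12322 ⟩ ⟨ 8731 , 930 , 9122 ⟩ ⟨ 8226 , 13218 , 34 ⟩)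
            (node ⟨ 8958 , 510 , 766 ⟩ ⟨ 4606 , 894 , 9086 ⟩ ⟨ 4990 , 13182 , 87 ⟩)
            (node ⟨ 4962 , 13154 , 9150 ⟩ ⟨ 8930 , 482 , 738 ⟩ ⟨ 4578 , 866 , 9058 ⟩))
          (node
            (node ⟨ 11006 , 4144 , 12336 ⟩ ⟨ 8232 , 944 , 9136 ⟩ ⟨ 8240 , 13232 , 48 ⟩)
            (node ⟨ 4964 , 13156 , 11198 ⟩ ⟨ 8932 , 484 , 740 ⟩ ⟨ 4580 , 868 , 9060 ⟩)
            (node ⟨ 4976 , 13168 , 744 ⟩ ⟨ 8944 , 496 , 752 ⟩ ⟨ 4592 , 880 , 9072 ⟩)))
        (node
          (node
            (node ⟨ 9371 , 6212 , 14404 ⟩ ⟨ 9755 , 3012 , 11204 ⟩ ⟨ 10308 , 15300 , 2116 ⟩)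
            (node ⟨ 6404 , 6224 , 14416 ⟩ ⟨ 10312 , 3024 , 11216 ⟩ ⟨ 10320 , 15312 , 2128 ⟩)
            (node ⟨ 6416 , 6672 , 14864 ⟩ ⟨ 10384 , 2312 , 2192 ⟩ ⟨ 10768 , 2320 , 2576 ⟩))
          (node
            (node ⟨ 4354 , 5168 , 13360 ⟩ ⟨ 9256 , 1968 , 10160 ⟩ ⟨ 9264 , 14256 , 1072 ⟩)
            (node ⟨ 5988 , 14180 , 9182 ⟩ ⟨ 9956 , 1508 , 1764 ⟩ ⟨ 5604 , 1892 , 10084 ⟩)
            (node ⟨ 6000 , 14192 , 1768 ⟩ ⟨ 9968 , 1520 , 1776 ⟩ ⟨ 5616 , 1904 , 10096 ⟩))
          (node
            (node ⟨ 4368 , 4624 , 12816 ⟩ ⟨ 8336 , 264 , 144 ⟩ ⟨ 8720 , 272 , 528 ⟩)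
            (node ⟨ 8048 , 16240 , 3816 ⟩ ⟨ 12016 , 3568 , 3824 ⟩ ⟨ 7664 , 3952 , 12144 ⟩)
            (node ⟨ 4356 , 4176 , 12368 ⟩ ⟨ 8264 , 976 , 9168 ⟩ ⟨ 8272 , 13264 , 80 ⟩))))
      (node
        (node
          (node
            (node ⟨ 5890 , 14082 , 11261 ⟩ ⟨ 9858 , 1410 , 1666 ⟩ ⟨ 5506 , 1794 , 9986 ⟩)
            (node ⟨ 9438 , 6241 , 1246 ⟩ ⟨ 9822 , 1374 , 1630 ⟩ ⟨ 5470 , 5726 , 13918 ⟩)
            (node ⟨ 5442 , 5698 , 13890 ⟩ ⟨ 9410 , 1822 , 1218 ⟩ ⟨ 9794 , 1346 , 1602 ⟩))
          (node
            (node ⟨ 5904 , 14096 , 1672 ⟩ ⟨ 9872 , 1424 , 1680 ⟩ ⟨ 5520 , 1808 , 10000 ⟩)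
            (node ⟨ 5444 , 5700 , 13892 ⟩ ⟨ 9412 , 3870 , 1220 ⟩ ⟨ 9796 , 1348 , 1604 ⟩)
            (node ⟨ 5456 , 5712 , 13904 ⟩ ⟨ 9424 , 1352 , 1232 ⟩ ⟨ 9808 , 1360 , 1616 ⟩))
          (node
            (node ⟨ 7492 , 7748 , 15940 ⟩ ⟨ 11460 , 3063 , 3268 ⟩ ⟨ 11844 , 3396 , 3652 ⟩)
            (node ⟨ 7504 , 7760 , 15952 ⟩ ⟨ 11472 , 3400 , 3280 ⟩ ⟨ 11856 , 3408 , 3664 ⟩)
            (node ⟨ 7952 , 16144 , 3720 ⟩ ⟨ 11920 , 3472 , 3728 ⟩ ⟨ 7568 , 3856 , 12048 ⟩)))
        (node
          (node
            (node ⟨ 10461 , 6244 , 14436 ⟩ ⟨ 10845 , 3044 , 11236 ⟩ ⟨ 10340 , 15332 , 2148 ⟩)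
            (node ⟨ 6436 , 6256 , 14448 ⟩ ⟨ 10344 , 3056 , 11248 ⟩ ⟨ 10352 , 15344 , 2160 ⟩)
            (node ⟨ 6448 , 6704 , 14896 ⟩ ⟨ 10416 , 2344 , 2224 ⟩ ⟨ 10800 , 2352 , 2608 ⟩))
          (node
            (node ⟨ 4386 , 4642 , 12834 ⟩ ⟨ 8354 , 795 , 162 ⟩ ⟨ 8738 , 290 , 546 ⟩)
            (node ⟨ 4439 , 1022 , 9214 ⟩ ⟨ 8318 , 13310 , 126 ⟩ ⟨ 8791 , 4222 , 12414 ⟩)
            (node ⟨ 8382 , 4194 , 12386 ⟩ ⟨ 8766 , 994 , 9186 ⟩ ⟨ 8290 , 13282 , 98 ⟩))
          (node
            (node ⟨ 4400 , 4656 , 12848 ⟩ ⟨ 8368 , 296 , 176 ⟩ ⟨ 8752 , 304 , 560 ⟩)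
            (node ⟨ 10430 , 4196 , 12388 ⟩ ⟨ 10814 , 996 , 9188 ⟩ ⟨ 8292 , 13284 , 100 ⟩)
            (node ⟨ 4388 , 4208 , 12400 ⟩ ⟨ 8296 , 1008 , 9200 ⟩ ⟨ 8304 , 13296 , 112 ⟩)))
        (node
          (node
            (node ⟨ 6468 , 6724 , 14916 ⟩ ⟨ 10436 , 1819 , 2244 ⟩ ⟨ 10820 , 2372 , 2628 ⟩)
            (node ⟨ 6480 , 6736 , 14928 ⟩ ⟨ 10448 , 2376 , 2256 ⟩ ⟨ 10832 , 2384 , 2640 ⟩)
            (node ⟨ 6928 , 15120 , 2696 ⟩ ⟨ 10896 , 2448 , 2704 ⟩ ⟨ 6544 , 2832 , 11024 ⟩))
          (node
            (node ⟨ 5424 , 5680 , 13872 ⟩ ⟨ 9392 , 1320 , 1200 ⟩ ⟨ 9776 , 1328 , 1584 ⟩)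
            (node ⟨ 8414 , 5220 , 13412 ⟩ ⟨ 8798 , 2020 , 10212 ⟩ ⟨ 9316 , 14308 , 1124 ⟩)
            (node ⟨ 5412 , 5232 , 13424 ⟩ ⟨ 9320 , 2032 , 10224 ⟩ ⟨ 9328 , 14320 , 1136 ⟩))
          (node
            (node ⟨ 4880 , 13072 , 648 ⟩ ⟨ 8848 , 400 , 656 ⟩ ⟨ 4496 , 784 , 8976 ⟩)
            (node ⟨ 4420 , 7280 , 15472 ⟩ ⟨ 11368 , 4080 , 12272 ⟩ ⟨ 11376 , 16368 , 3184 ⟩)
            (node ⟨ 4432 , 4688 , 12880 ⟩ ⟨ 8400 , 328 , 208 ⟩ ⟨ 8784 , 336 , 592 ⟩))))
      (node
        (node
          (node
            (node ⟨ 10493 , 5122 , 13314 ⟩ ⟨ 10877 , 1922 , 10114 ⟩ ⟨ 9218 , 14210 , 1026 ⟩)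
            (node ⟨ 9950 , 1502 , 1758 ⟩ ⟨ 5598 , 1886 , 10078 ⟩ ⟨ 5982 , 14174 , 2657 ⟩)
            (node ⟨ 5954 , 14146 , 10142 ⟩ ⟨ 9922 , 1474 , 1730 ⟩ ⟨ 5570 , 1858 , 10050 ⟩))
          (node
            (node ⟨ 11998 , 5136 , 13328 ⟩ ⟨ 9224 , 1936 , 10128 ⟩ ⟨ 9232 , 14224 , 1040 ⟩)
            (node ⟨ 5956 , 14148 , 12190 ⟩ ⟨ 9924 , 1476 , 1732 ⟩ ⟨ 5572 , 1860 , 10052 ⟩)
            (node ⟨ 5968 , 14160 , 1736 ⟩ ⟨ 9936 , 1488 , 1744 ⟩ ⟨ 5584 , 1872 , 10064 ⟩))
          (node
            (node ⟨ 8004 , 16196 , 14967 ⟩ ⟨ 11972 , 3524 , 3780 ⟩ ⟨ 7620 , 3908 , 12100 ⟩)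
            (node ⟨ 8016 , 16208 , 3784 ⟩ ⟨ 11984 , 3536 , 3792 ⟩ ⟨ 7632 , 3920 , 12112 ⟩)
            (node ⟨ 4449 , 7184 , 15376 ⟩ ⟨ 11272 , 3984 , 12176 ⟩ ⟨ 11280 , 16272 , 3088 ⟩)))
        (node
          (node
            (node ⟨ 6500 , 6756 , 14948 ⟩ ⟨ 10468 , 2909 , 2276 ⟩ ⟨ 10852 , 2404 , 2660 ⟩)
            (node ⟨ 6512 , 6768 , 14960 ⟩ ⟨ 10480 , 2408 , 2288 ⟩ ⟨ 10864 , 2416 , 2672 ⟩)
            (node ⟨ 6960 , 15152 , 2728 ⟩ ⟨ 10928 , 2480 , 2736 ⟩ ⟨ 6576 , 2864 , 11056 ⟩))
          (node
            (node ⟨ 4898 , 13090 , 9115 ⟩ ⟨ 8866 , 418 , 674 ⟩ ⟨ 4514 , 802 , 8994 ⟩)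
            (node ⟨ 8446 , 13143 , 254 ⟩ ⟨ 8830 , 382 , 638 ⟩ ⟨ 4478 , 4734 , 12926 ⟩)
            (node ⟨ 4450 , 4706 , 12898 ⟩ ⟨ 8418 , 830 , 226 ⟩ ⟨ 8802 , 354 , 610 ⟩))
          (node
            (node ⟨ 4912 , 13104 , 680 ⟩ ⟨ 8880 , 432 , 688 ⟩ ⟨ 4528 , 816 , 9008 ⟩)
            (node ⟨ 4452 , 4708 , 12900 ⟩ ⟨ 8420 , 2878 , 228 ⟩ ⟨ 8804 , 356 , 612 ⟩)
            (node ⟨ 4464 , 4720 , 12912 ⟩ ⟨ 8432 , 360 , 240 ⟩ ⟨ 8816 , 368 , 624 ⟩)))
        (node
          (node
            (node ⟨ 6980 , 15172 , 10139 ⟩ ⟨ 10948 , 2500 , 2756 ⟩ ⟨ 6596 , 2884 , 11076 ⟩)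
            (node ⟨ 6992 , 15184 , 2760 ⟩ ⟨ 10960 , 2512 , 2768 ⟩ ⟨ 6608 , 2896 , 11088 ⟩)
            (node ⟨ 5474 , 6160 , 14352 ⟩ ⟨ 10248 , 2960 , 11152 ⟩ ⟨ 10256 , 15248 , 2064 ⟩))
          (node
            (node ⟨ 5936 , 14128 , 1704 ⟩ ⟨ 9904 , 1456 , 1712 ⟩ ⟨ 5552 , 1840 , 10032 ⟩)
            (node ⟨ 5476 , 5732 , 13924 ⟩ ⟨ 9444 , 862 , 1252 ⟩ ⟨ 9828 , 1380 , 1636 ⟩)
            (node ⟨ 5488 , 5744 , 13936 ⟩ ⟨ 9456 , 1384 , 1264 ⟩ ⟨ 9840 , 1392 , 1648 ⟩))
          (node
            (node ⟨ 7524 , 4112 , 12304 ⟩ ⟨ 8200 , 912 , 9104 ⟩ ⟨ 8208 , 13200 , 16 ⟩)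
            (node ⟨ 7536 , 7792 , 15984 ⟩ ⟨ 11504 , 3432 , 3312 ⟩ ⟨ 11888 , 3440 , 3696 ⟩)
            (node ⟨ 4944 , 13136 , 712 ⟩ ⟨ 8912 , 464 , 720 ⟩ ⟨ 4560 , 848 , 9040 ⟩)))))
    (node
      (node
        (node
          (node
            (node ⟨ 5394 , 5650 , 13842 ⟩ ⟨ 9362 , 1290 , 1170 ⟩ ⟨ 9746 , 1298 , 1554 ⟩)
            (node ⟨ 7025 , 5190 , 13382 ⟩ ⟨ 10993 , 1990 , 10182 ⟩ ⟨ 9286 , 14278 , 1094 ⟩)
            (node ⟨ 5382 , 5202 , 13394 ⟩ ⟨ 9290 , 2002 , 10194 ⟩ ⟨ 9298 , 14290 , 1106 ⟩))
          (node
            (node ⟨ 9368 , 7238 , 1176 ⟩ ⟨ 9752 , 1304 , 1560 ⟩ ⟨ 5400 , 5656 , 13848 ⟩)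
            (node ⟨ 7430 , 5204 , 13396 ⟩ ⟨ 9292 , 2004 , 10196 ⟩ ⟨ 9300 , 14292 , 1108 ⟩)
            (node ⟨ 5396 , 2008 , 10200 ⟩ ⟨ 9304 , 14296 , 1112 ⟩ ⟨ 9748 , 5208 , 13400 ⟩))
          (node
            (node ⟨ 11007 , 7252 , 15444 ⟩ ⟨ 11340 , 4052 , 12244 ⟩ ⟨ 11348 , 16340 , 3156 ⟩)
            (node ⟨ 7444 , 4056 , 12248 ⟩ ⟨ 11352 , 16344 , 3160 ⟩ ⟨ 11796 , 7256 , 15448 ⟩)
            (node ⟨ 11416 , 13169 , 3224 ⟩ ⟨ 11800 , 3352 , 3608 ⟩ ⟨ 7448 , 7704 , 15896 ⟩)))
        (node
          (node
            (node ⟨ 7028 , 15220 , 2796 ⟩ ⟨ 10996 , 2548 , 2804 ⟩ ⟨ 6644 , 2932 , 11124 ⟩)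
            (node ⟨ 11000 , 2552 , 2808 ⟩ ⟨ 6648 , 2936 , 11128 ⟩ ⟨ 7032 , 15224 , 2100 ⟩)
            (node ⟨ 6417 , 3000 , 11192 ⟩ ⟨ 10296 , 15288 , 2104 ⟩ ⟨ 10769 , 6200 , 14392 ⟩))
          (node
            (node ⟨ 4355 , 4146 , 12338 ⟩ ⟨ 8234 , 946 , 9138 ⟩ ⟨ 8242 , 13234 , 50 ⟩)
            (node ⟨ 4966 , 13158 , 9183 ⟩ ⟨ 8934 , 486 , 742 ⟩ ⟨ 4582 , 870 , 9062 ⟩)
            (node ⟨ 4978 , 13170 , 746 ⟩ ⟨ 8946 , 498 , 754 ⟩ ⟨ 4594 , 882 , 9074 ⟩))
          (node
            (node ⟨ 7014 , 952 , 9144 ⟩ ⟨ 8248 , 13240 , 56 ⟩ ⟨ 6630 , 4152 , 12344 ⟩)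
            (node ⟨ 4980 , 13172 , 748 ⟩ ⟨ 8948 , 500 , 756 ⟩ ⟨ 4596 , 884 , 9076 ⟩)
            (node ⟨ 8952 , 504 , 760 ⟩ ⟨ 4600 , 888 , 9080 ⟩ ⟨ 4984 , 13176 , 52 ⟩)))
        (node
          (node
            (node ⟨ 5379 , 6228 , 14420 ⟩ ⟨ 10316 , 3028 , 11220 ⟩ ⟨ 10324 , 15316 , 2132 ⟩)
            (node ⟨ 6420 , 3032 , 11224 ⟩ ⟨ 10328 , 15320 , 2136 ⟩ ⟨ 10772 , 6232 , 14424 ⟩)
            (node ⟨ 10392 , 14194 , 2200 ⟩ ⟨ 10776 , 2328 , 2584 ⟩ ⟨ 6424 , 6680 , 14872 ⟩))
          (node
            (node ⟨ 4370 , 1976 , 10168 ⟩ ⟨ 9272 , 14264 , 1080 ⟩ ⟨ 8722 , 5176 , 13368 ⟩)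
            (node ⟨ 6004 , 14196 , 1772 ⟩ ⟨ 9972 , 1524 , 1780 ⟩ ⟨ 5620 , 1908 , 10100 ⟩)
            (node ⟨ 9976 , 1528 , 1784 ⟩ ⟨ 5624 , 1912 , 10104 ⟩ ⟨ 6008 , 14200 , 1076 ⟩))
          (node
            (node ⟨ 8344 , 16244 , 152 ⟩ ⟨ 8728 , 280 , 536 ⟩ ⟨ 4376 , 4632 , 12824 ⟩)
            (node ⟨ 12024 , 3576 , 3832 ⟩ ⟨ 7672 , 3960 , 12152 ⟩ ⟨ 8056 , 16248 , 84 ⟩)
            (node ⟨ 4372 , 984 , 9176 ⟩ ⟨ 8280 , 13272 , 88 ⟩ ⟨ 8724 , 4184 , 12376 ⟩))))
      (node
        (node
          (node
            (node ⟨ 5906 , 14098 , 1674 ⟩ ⟨ 9874 , 1426 , 1682 ⟩ ⟨ 5522 , 1810 , 10002 ⟩)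
            (node ⟨ 5446 , 5702 , 13894 ⟩ ⟨ 9414 , 3057 , 1222 ⟩ ⟨ 9798 , 1350 , 1606 ⟩)
            (node ⟨ 5458 , 5714 , 13906 ⟩ ⟨ 9426 , 1354 , 1234 ⟩ ⟨ 9810 , 1362 , 1618 ⟩))
          (node
            (node ⟨ 9880 , 1432 , 1688 ⟩ ⟨ 5528 , 1816 , 10008 ⟩ ⟨ 5912 , 14104 , 3654 ⟩)
            (node ⟨ 5460 , 5716 , 13908 ⟩ ⟨ 9428 , 1356 , 1236 ⟩ ⟨ 9812 , 1364 , 1620 ⟩)
            (node ⟨ 9432 , 14100 , 1240 ⟩ ⟨ 9816 , 1368 , 1624 ⟩ ⟨ 5464 , 5720 , 13912 ⟩))
          (node
            (node ⟨ 7508 , 7764 , 15956 ⟩ ⟨ 11476 , 3404 , 3284 ⟩ ⟨ 11860 , 3412 , 3668 ⟩)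
            (node ⟨ 11480 , 16148 , 3288 ⟩ ⟨ 11864 , 3416 , 3672 ⟩ ⟨ 7512 , 7768 , 15960 ⟩)
            (node ⟨ 11928 , 3480 , 3736 ⟩ ⟨ 7576 , 3864 , 12056 ⟩ ⟨ 7960 , 16152 , 113 ⟩)))
        (node
          (node
            (node ⟨ 6469 , 6260 , 14452 ⟩ ⟨ 10348 , 3060 , 11252 ⟩ ⟨ 10356 , 15348 , 2164 ⟩)
            (node ⟨ 6452 , 3064 , 11256 ⟩ ⟨ 10360 , 15352 , 2168 ⟩ ⟨ 10804 , 6264 , 14456 ⟩)
            (node ⟨ 10424 , 15121 , 2232 ⟩ ⟨ 10808 , 2360 , 2616 ⟩ ⟨ 6456 , 6712 , 14904 ⟩))
          (node
            (node ⟨ 4402 , 4658 , 12850 ⟩ ⟨ 8370 , 298 , 178 ⟩ ⟨ 8754 , 306 , 562 ⟩)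
            (node ⟨ 8415 , 4198 , 12390 ⟩ ⟨ 8799 , 998 , 9190 ⟩ ⟨ 8294 , 13286 , 102 ⟩)
            (node ⟨ 4390 , 4210 , 12402 ⟩ ⟨ 8298 , 1010 , 9202 ⟩ ⟨ 8306 , 13298 , 114 ⟩))
          (node
            (node ⟨ 8376 , 6246 , 184 ⟩ ⟨ 8760 , 312 , 568 ⟩ ⟨ 4408 , 4664 , 12856 ⟩)
            (node ⟨ 6438 , 4212 , 12404 ⟩ ⟨ 8300 , 1012 , 9204 ⟩ ⟨ 8308 , 13300 , 116 ⟩)
            (node ⟨ 4404 , 1016 , 9208 ⟩ ⟨ 8312 , 13304 , 120 ⟩ ⟨ 8756 , 4216 , 12408 ⟩)))
        (node
          (node
            (node ⟨ 6484 , 6740 , 14932 ⟩ ⟨ 10452 , 2380 , 2260 ⟩ ⟨ 10836 , 2388 , 2644 ⟩)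
            (node ⟨ 10456 , 15124 , 2264 ⟩ ⟨ 10840 , 2392 , 2648 ⟩ ⟨ 6488 , 6744 , 14936 ⟩)
            (node ⟨ 10904 , 2456 , 2712 ⟩ ⟨ 6552 , 2840 , 11032 ⟩ ⟨ 6936 , 15128 , 1138 ⟩))
          (node
            (node ⟨ 9400 , 13074 , 1208 ⟩ ⟨ 9784 , 1336 , 1592 ⟩ ⟨ 5432 , 5688 , 13880 ⟩)
            (node ⟨ 4422 , 5236 , 13428 ⟩ ⟨ 9324 , 2036 , 10228 ⟩ ⟨ 9332 , 14324 , 1140 ⟩)
            (node ⟨ 5428 , 2040 , 10232 ⟩ ⟨ 9336 , 14328 , 1144 ⟩ ⟨ 9780 , 5240 , 13432 ⟩))
          (node
            (node ⟨ 8856 , 408 , 664 ⟩ ⟨ 4504 , 792 , 8984 ⟩ ⟨ 4888 , 13080 , 3188 ⟩)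
            (node ⟨ 4436 , 4088 , 12280 ⟩ ⟨ 11384 , 16376 , 3192 ⟩ ⟨ 8788 , 7288 , 15480 ⟩)
            (node ⟨ 8408 , 13076 , 216 ⟩ ⟨ 8792 , 344 , 600 ⟩ ⟨ 4440 , 4696 , 12888 ⟩))))
      (node
        (node
          (node
            (node ⟨ 6501 , 5138 , 13330 ⟩ ⟨ 9226 , 1938 , 10130 ⟩ ⟨ 9234 , 14226 , 1042 ⟩)
            (node ⟨ 5958 , 14150 , 14961 ⟩ ⟨ 9926 , 1478 , 1734 ⟩ ⟨ 5574 , 1862 , 10054 ⟩)
            (node ⟨ 5970 , 14162 , 1738 ⟩ ⟨ 9938 , 1490 , 1746 ⟩ ⟨ 5586 , 1874 , 10066 ⟩))
          (node
            (node ⟨ 8006 , 1944 , 10136 ⟩ ⟨ 9240 , 14232 , 1048 ⟩ ⟨ 7622 , 5144 , 13336 ⟩)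
            (node ⟨ 5972 , 14164 , 1740 ⟩ ⟨ 9940 , 1492 , 1748 ⟩ ⟨ 5588 , 1876 , 10068 ⟩)
            (node ⟨ 9944 , 1496 , 1752 ⟩ ⟨ 5592 , 1880 , 10072 ⟩ ⟨ 5976 , 14168 , 1044 ⟩))
          (node
            (node ⟨ 8020 , 16212 , 3788 ⟩ ⟨ 11988 , 3540 , 3796 ⟩ ⟨ 7636 , 3924 , 12116 ⟩)
            (node ⟨ 11992 , 3544 , 3800 ⟩ ⟨ 7640 , 3928 , 12120 ⟩ ⟨ 8024 , 16216 , 3092 ⟩)
            (node ⟨ 4465 , 3992 , 12184 ⟩ ⟨ 11288 , 16280 , 3096 ⟩ ⟨ 8817 , 7192 , 15384 ⟩)))
        (node
          (node
            (node ⟨ 6516 , 6772 , 14964 ⟩ ⟨ 10484 , 2412 , 2292 ⟩ ⟨ 10868 , 2420 , 2676 ⟩)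
            (node ⟨ 10488 , 15156 , 2296 ⟩ ⟨ 10872 , 2424 , 2680 ⟩ ⟨ 6520 , 6776 , 14968 ⟩)
            (node ⟨ 10936 , 2488 , 2744 ⟩ ⟨ 6584 , 2872 , 11064 ⟩ ⟨ 6968 , 15160 , 2065 ⟩))
          (node
            (node ⟨ 4914 , 13106 , 682 ⟩ ⟨ 8882 , 434 , 690 ⟩ ⟨ 4530 , 818 , 9010 ⟩)
            (node ⟨ 4454 , 4710 , 12902 ⟩ ⟨ 8422 , 863 , 230 ⟩ ⟨ 8806 , 358 , 614 ⟩)
            (node ⟨ 4466 , 4722 , 12914 ⟩ ⟨ 8434 , 362 , 242 ⟩ ⟨ 8818 , 370 , 626 ⟩))
          (node
            (node ⟨ 8888 , 440 , 696 ⟩ ⟨ 4536 , 824 , 9016 ⟩ ⟨ 4920 , 13112 , 2662 ⟩)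
            (node ⟨ 4468 , 4724 , 12916 ⟩ ⟨ 8436 , 364 , 244 ⟩ ⟨ 8820 , 372 , 628 ⟩)
            (node ⟨ 8440 , 13108 , 248 ⟩ ⟨ 8824 , 376 , 632 ⟩ ⟨ 4472 , 4728 , 12920 ⟩)))
        (node
          (node
            (node ⟨ 6996 , 15188 , 2764 ⟩ ⟨ 10964 , 2516 , 2772 ⟩ ⟨ 6612 , 2900 , 11092 ⟩)
            (node ⟨ 10968 , 2520 , 2776 ⟩ ⟨ 6616 , 2904 , 11096 ⟩ ⟨ 7000 , 15192 , 2068 ⟩)
            (node ⟨ 5490 , 2968 , 11160 ⟩ ⟨ 10264 , 15256 , 2072 ⟩ ⟨ 9842 , 6168 , 14360 ⟩))
          (node
            (node ⟨ 9912 , 1464 , 1720 ⟩ ⟨ 5560 , 1848 , 10040 ⟩ ⟨ 5944 , 14136 , 18 ⟩)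
            (node ⟨ 5492 , 5748 , 13940 ⟩ ⟨ 9460 , 1388 , 1268 ⟩ ⟨ 9844 , 1396 , 1652 ⟩)
            (node ⟨ 9464 , 14132 , 1272 ⟩ ⟨ 9848 , 1400 , 1656 ⟩ ⟨ 5496 , 5752 , 13944 ⟩))
          (node
            (node ⟨ 7540 , 920 , 9112 ⟩ ⟨ 8216 , 13208 , 24 ⟩ ⟨ 11892 , 4120 , 12312 ⟩)
            (node ⟨ 11512 , 13140 , 3320 ⟩ ⟨ 11896 , 3448 , 3704 ⟩ ⟨ 7544 , 7800 , 15992 ⟩)
            (node ⟨ 8920 , 472 , 728 ⟩ ⟨ 4568 , 856 , 9048 ⟩ ⟨ 4952 , 13144 , 20 ⟩)))))
    (node
      (node
        (node
          (node
            (node ⟨ 9370 , 15221 , 1178 ⟩ ⟨ 9754 , 1306 , 1562 ⟩ ⟨ 5402 , 5658 , 13850 ⟩)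
            (node ⟨ 11001 , 5206 , 13398 ⟩ ⟨ 9294 , 2006 , 10198 ⟩ ⟨ 9302 , 14294 , 1110 ⟩)
            (node ⟨ 5398 , 2010 , 10202 ⟩ ⟨ 9306 , 14298 , 1114 ⟩ ⟨ 9750 , 5210 , 13402 ⟩))
          (node
            (node ⟨ 5376 , 5632 , 13824 ⟩ ⟨ 9344 , 4054 , 1152 ⟩ ⟨ 9728 , 1280 , 1536 ⟩)
            (node ⟨ 7446 , 2012 , 10204 ⟩ ⟨ 9308 , 14300 , 1116 ⟩ ⟨ 11798 , 5212 , 13404 ⟩)
            (node ⟨ 9372 , 5184 , 13376 ⟩ ⟨ 9756 , 1984 , 10176 ⟩ ⟨ 9280 , 14272 , 1088 ⟩))
          (node
            (node ⟨ 7015 , 4060 , 12252 ⟩ ⟨ 11356 , 16348 , 3164 ⟩ ⟨ 6631 , 7260 , 15452 ⟩)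
            (node ⟨ 11420 , 7232 , 15424 ⟩ ⟨ 11804 , 4032 , 12224 ⟩ ⟨ 11328 , 16320 , 3136 ⟩)
            (node ⟨ 7424 , 7680 , 15872 ⟩ ⟨ 11392 , 889 , 3200 ⟩ ⟨ 11776 , 3328 , 3584 ⟩)))
        (node
          (node
            (node ⟨ 11004 , 2556 , 2812 ⟩ ⟨ 6652 , 2940 , 11132 ⟩ ⟨ 7036 , 15228 , 2133 ⟩)
            (node ⟨ 7008 , 15200 , 11196 ⟩ ⟨ 10976 , 2528 , 2784 ⟩ ⟨ 6624 , 2912 , 11104 ⟩)
            (node ⟨ 10393 , 6176 , 14368 ⟩ ⟨ 10777 , 2976 , 11168 ⟩ ⟨ 10272 , 15264 , 2080 ⟩))
          (node
            (node ⟨ 4371 , 954 , 9146 ⟩ ⟨ 8250 , 13242 , 58 ⟩ ⟨ 8723 , 4154 , 12346 ⟩)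
            (node ⟨ 4982 , 13174 , 750 ⟩ ⟨ 8950 , 502 , 758 ⟩ ⟨ 4598 , 886 , 9078 ⟩)
            (node ⟨ 8954 , 506 , 762 ⟩ ⟨ 4602 , 890 , 9082 ⟩ ⟨ 4986 , 13178 , 54 ⟩))
          (node
            (node ⟨ 7030 , 4128 , 12320 ⟩ ⟨ 10998 , 928 , 9120 ⟩ ⟨ 8224 , 13216 , 32 ⟩)
            (node ⟨ 8956 , 508 , 764 ⟩ ⟨ 4604 , 892 , 9084 ⟩ ⟨ 4988 , 13180 , 2102 ⟩)
            (node ⟨ 4960 , 13152 , 9148 ⟩ ⟨ 8928 , 480 , 736 ⟩ ⟨ 4576 , 864 , 9056 ⟩)))
        (node
          (node
            (node ⟨ 5395 , 3036 , 11228 ⟩ ⟨ 10332 , 15324 , 2140 ⟩ ⟨ 9747 , 6236 , 14428 ⟩)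
            (node ⟨ 10396 , 6208 , 14400 ⟩ ⟨ 10780 , 3008 , 11200 ⟩ ⟨ 10304 , 15296 , 2112 ⟩)
            (node ⟨ 6400 , 6656 , 14848 ⟩ ⟨ 10368 , 1914 , 2176 ⟩ ⟨ 10752 , 2304 , 2560 ⟩))
          (node
            (node ⟨ 8346 , 5152 , 13344 ⟩ ⟨ 8730 , 1952 , 10144 ⟩ ⟨ 9248 , 14240 , 1056 ⟩)
            (node ⟨ 9980 , 1532 , 1788 ⟩ ⟨ 5628 , 1916 , 10108 ⟩ ⟨ 6012 , 14204 , 86 ⟩)
            (node ⟨ 5984 , 14176 , 10172 ⟩ ⟨ 9952 , 1504 , 1760 ⟩ ⟨ 5600 , 1888 , 10080 ⟩))
          (node
            (node ⟨ 4352 , 4608 , 12800 ⟩ ⟨ 8320 , 3964 , 128 ⟩ ⟨ 8704 , 256 , 512 ⟩)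
            (node ⟨ 8032 , 16224 , 9180 ⟩ ⟨ 12000 , 3552 , 3808 ⟩ ⟨ 7648 , 3936 , 12128 ⟩)
            (node ⟨ 8348 , 4160 , 12352 ⟩ ⟨ 8732 , 960 , 9152 ⟩ ⟨ 8256 , 13248 , 64 ⟩))))
      (node
        (node
          (node
            (node ⟨ 9882 , 1434 , 1690 ⟩ ⟨ 5530 , 1818 , 10010 ⟩ ⟨ 5914 , 14106 , 2165 ⟩)
            (node ⟨ 5462 , 5718 , 13910 ⟩ ⟨ 9430 , 1358 , 1238 ⟩ ⟨ 9814 , 1366 , 1622 ⟩)
            (node ⟨ 9434 , 14102 , 1242 ⟩ ⟨ 9818 , 1370 , 1626 ⟩ ⟨ 5466 , 5722 , 13914 ⟩))
          (node
            (node ⟨ 5888 , 14080 , 15958 ⟩ ⟨ 9856 , 1408 , 1664 ⟩ ⟨ 5504 , 1792 , 9984 ⟩)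
            (node ⟨ 9436 , 16150 , 1244 ⟩ ⟨ 9820 , 1372 , 1628 ⟩ ⟨ 5468 , 5724 , 13916 ⟩)
            (node ⟨ 5440 , 5696 , 13888 ⟩ ⟨ 9408 , 1820 , 1216 ⟩ ⟨ 9792 , 1344 , 1600 ⟩))
          (node
            (node ⟨ 11484 , 6247 , 3292 ⟩ ⟨ 11868 , 3420 , 3676 ⟩ ⟨ 7516 , 7772 , 15964 ⟩)
            (node ⟨ 7488 , 7744 , 15936 ⟩ ⟨ 11456 , 3868 , 3264 ⟩ ⟨ 11840 , 3392 , 3648 ⟩)
            (node ⟨ 7936 , 16128 , 9209 ⟩ ⟨ 11904 , 3456 , 3712 ⟩ ⟨ 7552 , 3840 , 12032 ⟩)))
        (node
          (node
            (node ⟨ 6485 , 3068 , 11260 ⟩ ⟨ 10364 , 15356 , 2172 ⟩ ⟨ 10837 , 6268 , 14460 ⟩)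
            (node ⟨ 10428 , 6240 , 14432 ⟩ ⟨ 10812 , 3040 , 11232 ⟩ ⟨ 10336 , 15328 , 2144 ⟩)
            (node ⟨ 6432 , 6688 , 14880 ⟩ ⟨ 10400 , 2841 , 2208 ⟩ ⟨ 10784 , 2336 , 2592 ⟩))
          (node
            (node ⟨ 8378 , 13075 , 186 ⟩ ⟨ 8762 , 314 , 570 ⟩ ⟨ 4410 , 4666 , 12858 ⟩)
            (node ⟨ 4423 , 4214 , 12406 ⟩ ⟨ 8302 , 1014 , 9206 ⟩ ⟨ 8310 , 13302 , 118 ⟩)
            (node ⟨ 4406 , 1018 , 9210 ⟩ ⟨ 8314 , 13306 , 122 ⟩ ⟨ 8758 , 4218 , 12410 ⟩))
          (node
            (node ⟨ 4384 , 4640 , 12832 ⟩ ⟨ 8352 , 3062 , 160 ⟩ ⟨ 8736 , 288 , 544 ⟩)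
            (node ⟨ 6454 , 1020 , 9212 ⟩ ⟨ 8316 , 13308 , 124 ⟩ ⟨ 10806 , 4220 , 12412 ⟩)
            (node ⟨ 8380 , 4192 , 12384 ⟩ ⟨ 8764 , 992 , 9184 ⟩ ⟨ 8288 , 13280 , 96 ⟩)))
        (node
          (node
            (node ⟨ 10460 , 14099 , 2268 ⟩ ⟨ 10844 , 2396 , 2652 ⟩ ⟨ 6492 , 6748 , 14940 ⟩)
            (node ⟨ 6464 , 6720 , 14912 ⟩ ⟨ 10432 , 2844 , 2240 ⟩ ⟨ 10816 , 2368 , 2624 ⟩)
            (node ⟨ 6912 , 15104 , 10234 ⟩ ⟨ 10880 , 2432 , 2688 ⟩ ⟨ 6528 , 2816 , 11008 ⟩))
          (node
            (node ⟨ 5408 , 5664 , 13856 ⟩ ⟨ 9376 , 794 , 1184 ⟩ ⟨ 9760 , 1312 , 1568 ⟩)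
            (node ⟨ 4438 , 2044 , 10236 ⟩ ⟨ 9340 , 14332 , 1148 ⟩ ⟨ 8790 , 5244 , 13436 ⟩)
            (node ⟨ 9404 , 5216 , 13408 ⟩ ⟨ 9788 , 2016 , 10208 ⟩ ⟨ 9312 , 14304 , 1120 ⟩))
          (node
            (node ⟨ 4864 , 13056 , 12284 ⟩ ⟨ 8832 , 384 , 640 ⟩ ⟨ 4480 , 768 , 8960 ⟩)
            (node ⟨ 8412 , 7264 , 15456 ⟩ ⟨ 8796 , 4064 , 12256 ⟩ ⟨ 11360 , 16352 , 3168 ⟩)
            (node ⟨ 4416 , 4672 , 12864 ⟩ ⟨ 8384 , 796 , 192 ⟩ ⟨ 8768 , 320 , 576 ⟩))))
      (node
        (node
          (node
            (node ⟨ 6517 , 1946 , 10138 ⟩ ⟨ 9242 , 14234 , 1050 ⟩ ⟨ 10869 , 5146 , 13338 ⟩)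
            (node ⟨ 5974 , 14166 , 1742 ⟩ ⟨ 9942 , 1494 , 1750 ⟩ ⟨ 5590 , 1878 , 10070 ⟩)
            (node ⟨ 9946 , 1498 , 1754 ⟩ ⟨ 5594 , 1882 , 10074 ⟩ ⟨ 5978 , 14170 , 1046 ⟩))
          (node
            (node ⟨ 8022 , 5120 , 13312 ⟩ ⟨ 11990 , 1920 , 10112 ⟩ ⟨ 9216 , 14208 , 1024 ⟩)
            (node ⟨ 9948 , 1500 , 1756 ⟩ ⟨ 5596 , 1884 , 10076 ⟩ ⟨ 5980 , 14172 , 3094 ⟩)
            (node ⟨ 5952 , 14144 , 10140 ⟩ ⟨ 9920 , 1472 , 1728 ⟩ ⟨ 5568 , 1856 , 10048 ⟩))
          (node
            (node ⟨ 11996 , 3548 , 3804 ⟩ ⟨ 7644 , 3932 , 12124 ⟩ ⟨ 8028 , 16220 , 2663 ⟩)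
            (node ⟨ 8000 , 16192 , 12188 ⟩ ⟨ 11968 , 3520 , 3776 ⟩ ⟨ 7616 , 3904 , 12096 ⟩)
            (node ⟨ 8441 , 7168 , 15360 ⟩ ⟨ 8825 , 3968 , 12160 ⟩ ⟨ 11264 , 16256 , 3072 ⟩)))
        (node
          (node
            (node ⟨ 10492 , 15189 , 2300 ⟩ ⟨ 10876 , 2428 , 2684 ⟩ ⟨ 6524 , 6780 , 14972 ⟩)
            (node ⟨ 6496 , 6752 , 14944 ⟩ ⟨ 10464 , 2876 , 2272 ⟩ ⟨ 10848 , 2400 , 2656 ⟩)
            (node ⟨ 6944 , 15136 , 11161 ⟩ ⟨ 10912 , 2464 , 2720 ⟩ ⟨ 6560 , 2848 , 11040 ⟩))
          (node
            (node ⟨ 8890 , 442 , 698 ⟩ ⟨ 4538 , 826 , 9018 ⟩ ⟨ 4922 , 13114 , 19 ⟩)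
            (node ⟨ 4470 , 4726 , 12918 ⟩ ⟨ 8438 , 366 , 246 ⟩ ⟨ 8822 , 374 , 630 ⟩)
            (node ⟨ 8442 , 13110 , 250 ⟩ ⟨ 8826 , 378 , 634 ⟩ ⟨ 4474 , 4730 , 12922 ⟩))
          (node
            (node ⟨ 4896 , 13088 , 14966 ⟩ ⟨ 8864 , 416 , 672 ⟩ ⟨ 4512 , 800 , 8992 ⟩)
            (node ⟨ 8444 , 15158 , 252 ⟩ ⟨ 8828 , 380 , 636 ⟩ ⟨ 4476 , 4732 , 12924 ⟩)
            (node ⟨ 4448 , 4704 , 12896 ⟩ ⟨ 8416 , 828 , 224 ⟩ ⟨ 8800 , 352 , 608 ⟩)))
        (node
          (node
            (node ⟨ 10972 , 2524 , 2780 ⟩ ⟨ 6620 , 2908 , 11100 ⟩ ⟨ 7004 , 15196 , 1043 ⟩)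
            (node ⟨ 6976 , 15168 , 11164 ⟩ ⟨ 10944 , 2496 , 2752 ⟩ ⟨ 6592 , 2880 , 11072 ⟩)
            (node ⟨ 9466 , 6144 , 14336 ⟩ ⟨ 9850 , 2944 , 11136 ⟩ ⟨ 10240 , 15232 , 2048 ⟩))
          (node
            (node ⟨ 5920 , 14112 , 9114 ⟩ ⟨ 9888 , 1440 , 1696 ⟩ ⟨ 5536 , 1824 , 10016 ⟩)
            (node ⟨ 9468 , 13142 , 1276 ⟩ ⟨ 9852 , 1404 , 1660 ⟩ ⟨ 5500 , 5756 , 13948 ⟩)
            (node ⟨ 5472 , 5728 , 13920 ⟩ ⟨ 9440 , 1852 , 1248 ⟩ ⟨ 9824 , 1376 , 1632 ⟩))
          (node
            (node ⟨ 11516 , 4096 , 12288 ⟩ ⟨ 11900 , 896 , 9088 ⟩ ⟨ 8192 , 13184 , 0 ⟩)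
            (node ⟨ 7520 , 7776 , 15968 ⟩ ⟨ 11488 , 860 , 3296 ⟩ ⟨ 11872 , 3424 , 3680 ⟩)
            (node ⟨ 4928 , 13120 , 9116 ⟩ ⟨ 8896 , 448 , 704 ⟩ ⟨ 4544 , 832 , 9024 ⟩)))))

lemma2p8 : Z3Connected Ga × Z3Connected Gb × Z3Connected Gc × Z3Connected Gd
lemma2p8 = connectedByCertificate Ga certificateA
         , connectedByCertificate Gb certificateB
         , connectedByCertificate Gc certificateC
         , connectedByCertificate Gd certificateD
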